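{- Let $n$ be a positive integer, $m=\lfloor n/2\rfloor$, and let $S=\{a_1<\dots<a_r\}\subseteq[0,n]$ be a $B_3$-sequence of size $r$ with characteristic function $\chi$ (so $\chi(t)=1$ if $t\in S$ and $\chi(t)=0$ otherwise). Define the following sets of integer triples: $$\mathcal{A}=\bigcup_{0\le i<j<k\le m}\{(i,j,k),(i,j,n-k),(k,n-j,n-i),(n-k,n-j,n-i)\},$$ $$\mathcal{A}'=\bigcup_{0\le i<j<k\le m}\{(i,k,n-j),(i,n-k,n-j),(j,n-k,n-i),(j,k,n-i)\},$$ $$\mathcal{B}=\bigcup_{0\le i<j\le m}\{(i,i,j),(i,i,n-j),(j,n-i,n-i),(n-j,n-i,n-i)\},\qquad \mathcal{B}'=\bigcup_{0\le i<j\le m}\{(i,j,n-i),(i,n-j,n-i)\}.$$ Let $$\Gamma=\sum_{(x,y,z)\in\mathcal{A}}\chi(x)\chi(y)\chi(z),\quad \tilde\Gamma=\Gamma+\frac12\sum_{(x,y,z)\in\mathcal{B}}\chi(x)\chi(y)\chi(z),\quad \bar\Gamma=\sum_{(x,y,z)\in\mathcal{A}'\cup\mathcal{B}'}\chi(x)\chi(y)\chi(z),$$ and $\Delta=\tilde\Gamma-\bar\Gamma$. Then $\Delta\ge 0$ and $$\Gamma\ge \frac{r^3}{12}+\frac{\Delta}{2}-\frac{3r^2}{8}-\frac{7r}{12}.$$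
   Context: A finite set $S$ of non-negative integers is a $B_3$-sequence if all sums of three of its elements (repetitions allowed) are different, i.e. whenever $x_1+x_2+x_3=y_1+y_2+y_3$ with all $x_i,y_i\in S$, the multisets $\{x_1,x_2,x_3\}$ and $\{y_1,y_2,y_3\}$ coincide. -}

module Defs where

open import Data.Nat using (ℕ; zero; suc; _+_; _*_; _∸_; _/_)
import Data.Nat.Properties as ℕP
open import Data.Integer using (+_)
open import Data.List using (List; []; _∷_; _++_; concatMap; upTo; map; length)
open import Data.Nat.ListAction using (sum)
open import Data.List.Membership.Propositional using (_∈_)
import Data.List.Membership.DecPropositional as DecMem
open import Data.List.Relation.Binary.Permutation.Propositional using (_↭_)
open import Data.Product using (_×_; _,_)
open import Data.Product.Properties using (≡-dec)
open import Relation.Nullary using (does)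
open import Relation.Binary.PropositionalEquality using (_≡_)
open import Relation.Binary.Definitions using (DecidableEquality)
open import Data.Bool using (if_then_else_)
open import Data.Rational as ℚ using (ℚ; ½)

-- integer triples (all coordinates here are in [0,n], so ℕ suffices)
Triple : Set
Triple = ℕ × ℕ × ℕ

_≟ᵗ_ : DecidableEquality Triple
_≟ᵗ_ = ≡-dec ℕP._≟_ (≡-dec ℕP._≟_ ℕP._≟_)

-- B₃-sequence: all sums of three elements (repetition allowed) are distinct
-- up to the multiset {x₁,x₂,x₃} (multiset equality = list permutation)
IsB3 : List ℕ → Set
IsB3 S = ∀ x₁ x₂ x₃ y₁ y₂ y₃ → x₁ ∈ S → x₂ ∈ S → x₃ ∈ S → y₁ ∈ S → y₂ ∈ S → y₃ ∈ S →
         x₁ + x₂ + x₃ ≡ y₁ + y₂ + y₃ →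
         (x₁ ∷ x₂ ∷ x₃ ∷ []) ↭ (y₁ ∷ y₂ ∷ y₃ ∷ [])

χ : List ℕ → ℕ → ℕ
χ S t = if does (DecMem._∈?_ ℕP._≟_ t S) then 1 else 0

[_∈ᵗ_] : Triple → List Triple → ℕ
[ t ∈ᵗ L ] = if does (DecMem._∈?_ _≟ᵗ_ t L) then 1 else 0

pairs : ℕ → List (ℕ × ℕ)
pairs m = concatMap (λ j → map (λ i → (i , j)) (upTo j)) (upTo (suc m))

triples : ℕ → List Triple
triples m = concatMap (λ k → concatMap (λ j → map (λ i → (i , j , k)) (upTo j)) (upTo k))
                      (upTo (suc m))

half : ℕ → ℕ
half n = n / 2

𝒜 : ℕ → List Triple
𝒜 n = concatMap (λ { (i , j , k) → (i , j , k) ∷ (i , j , n ∸ k) ∷ (k , n ∸ j , n ∸ i)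
                                     ∷ (n ∸ k , n ∸ j , n ∸ i) ∷ [] })
                (triples (half n))

𝒜′ : ℕ → List Triple
𝒜′ n = concatMap (λ { (i , j , k) → (i , k , n ∸ j) ∷ (i , n ∸ k , n ∸ j) ∷ (j , n ∸ k , n ∸ i)
                                      ∷ (j , k , n ∸ i) ∷ [] })
                 (triples (half n))

ℬ : ℕ → List Triple
ℬ n = concatMap (λ { (i , j) → (i , i , j) ∷ (i , i , n ∸ j) ∷ (j , n ∸ i , n ∸ i)
                                 ∷ (n ∸ j , n ∸ i , n ∸ i) ∷ [] })
                (pairs (half n))

ℬ′ : ℕ → List Triple
ℬ′ n = concatMap (λ { (i , j) → (i , j , n ∸ i) ∷ (i , n ∸ j , n ∸ i) ∷ [] })
                 (pairs (half n))

sumCube : ℕ → (ℕ → ℕ → ℕ → ℕ) → ℕ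
sumCube n f = sum (map (λ x → sum (map (λ y → sum (map (λ z → f x y z)
                  (upTo (suc n)))) (upTo (suc n)))) (upTo (suc n)))

-- Σ_{(x,y,z) ∈ set L} χ(x)χ(y)χ(z); each element of the SET counts once
-- (duplicates in the list L are irrelevant). All triples considered lie in [0,n]³.
weight : List ℕ → ℕ → List Triple → ℕ
weight S n L = sumCube n (λ x y z → [ (x , y , z) ∈ᵗ L ] * (χ S x * χ S y * χ S z))

toℚ : ℕ → ℚ
toℚ k = + k ℚ./ 1

Γ : List ℕ → ℕ → ℚ
Γ S n = toℚ (weight S n (𝒜 n))

Γ̃ : List ℕ → ℕ → ℚ
Γ̃ S n = Γ S n ℚ.+ ½ ℚ.* toℚ (weight S n (ℬ n))

-- union 𝒜′ ∪ ℬ′ (list concatenation; membership = membership in either)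
Γ̄ : List ℕ → ℕ → ℚ
Γ̄ S n = toℚ (weight S n (𝒜′ n ++ ℬ′ n))

Δ : List ℕ → ℕ → ℚ
Δ S n = Γ̃ S n ℚ.- Γ̄ S n

-- Fold [0, n] onto [0, m] by identifying x with n ∸ x. With a = χ, b = χ (n ∸ ·) and
-- σ k = |S ∩ {k , n ∸ k}| for k ≤ m, the sets 𝒜, 𝒜′, ℬ, ℬ′ split into disjoint blocks indexed by
-- i < j < k ≤ m (resp. i < j ≤ m), and the χ-weight of each block is σ k times a quadratic
-- expression in a and b. Writing α, β, ρ = α + β for prefix sums of a, b, σ, this gives
--   Γ = Σₖ σₖ Pₖ,  Γ̄ = Σₖ σₖ Qₖ,  weight ℬ = Σₖ σₖ ρₖ,
-- where, as a and b are 0/1-valued, 2Pₖ + ρₖ = αₖ² + βₖ² and Qₖ = αₖβₖ. Hence 2Qₖ ≤ 2Pₖ + ρₖ,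
-- which is Δ ≥ 0, and 2Pₖ + 2Qₖ + ρₖ = ρₖ², so Σₖ σₖ ρₖ² = 2Γ + 2Γ̄ + weight ℬ.
-- Finally σ takes values in {0, 1, 2}, the value 2 at most once because S is a B₃-sequence, and
-- Σₖ σₖ = |S|; for such sequences discrete integration gives
--   12 Σₖ σₖ ρₖ + 2|S|³ ≤ 6 Σₖ σₖ ρₖ² + 9|S|² + 14|S|,
-- which rearranges to the lower bound on Γ.

module Submission where

open import Defs
open import Data.Nat using (ℕ; zero; suc; _≤_; _<_; z≤n; s≤s)
open import Data.List using (List; []; _∷_; _++_; map; length; upTo)
open import Data.List.Relation.Unary.All using (All)
open import Data.List.Relation.Unary.Unique.Propositional using (Unique)
open import Data.List.Membership.Propositional using (_∈_; _∉_)
open import Data.List.Relation.Unary.Any using (here; there)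
open import Data.Product using (_×_; _,_)
open import Data.Sum using (_⊎_; inj₁; inj₂)
open import Relation.Nullary using (¬_; Dec; yes; no)
open import Relation.Binary.PropositionalEquality using (_≡_; _≢_; refl; sym; trans; cong; cong₂; subst)

module FiniteSums where
  open import Data.Nat using (_+_; _*_)
  open import Data.Nat.Properties
    using (+-mono-≤; *-zeroʳ; *-distribˡ-+; *-comm; *-assoc; +-identityʳ; +-commutativeSemigroup)
  open import Data.Nat.ListAction using (sum)
  open import Data.Nat.ListAction.Properties using (sum-++)
  open import Data.List.Properties using (map-++; upTo-∷ʳ)
  open import Data.List.Membership.Propositional.Properties using (∈-upTo⁻)
  open import Algebra.Properties.CommutativeSemigroup +-commutativeSemigroup using (interchange)

  ∑ : {A : Set} → List A → (A → ℕ) → ℕ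
  ∑ xs f = sum (map f xs)

  module _ {A : Set} where

    ∑-++ : (xs ys : List A) (f : A → ℕ) → ∑ (xs ++ ys) f ≡ ∑ xs f + ∑ ys f
    ∑-++ xs ys f = trans (cong sum (map-++ f xs ys)) (sum-++ (map f xs) (map f ys))

    ∑-cong : (xs : List A) {f g : A → ℕ} → (∀ x → x ∈ xs → f x ≡ g x) → ∑ xs f ≡ ∑ xs g
    ∑-cong []       f≗g = refl
    ∑-cong (x ∷ xs) f≗g = cong₂ _+_ (f≗g x (here refl)) (∑-cong xs (λ y y∈ → f≗g y (there y∈)))

    ∑-zero : (xs : List A) {f : A → ℕ} → (∀ x → x ∈ xs → f x ≡ 0) → ∑ xs f ≡ 0
    ∑-zero []       f≗0 = refl
    ∑-zero (x ∷ xs) f≗0 = cong₂ _+_ (f≗0 x (here refl)) (∑-zero xs (λ y y∈ → f≗0 y (there y∈)))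

    ∑-mono : (xs : List A) {f g : A → ℕ} → (∀ x → x ∈ xs → f x ≤ g x) → ∑ xs f ≤ ∑ xs g
    ∑-mono []       f≤g = z≤n
    ∑-mono (x ∷ xs) f≤g = +-mono-≤ (f≤g x (here refl)) (∑-mono xs (λ y y∈ → f≤g y (there y∈)))

    ∑-+ : (xs : List A) (f g : A → ℕ) → ∑ xs (λ x → f x + g x) ≡ ∑ xs f + ∑ xs g
    ∑-+ []       f g = refl
    ∑-+ (x ∷ xs) f g =
      trans (cong ((f x + g x) +_) (∑-+ xs f g)) (interchange (f x) (g x) (∑ xs f) (∑ xs g))

    ∑-*ˡ : (xs : List A) (c : ℕ) (f : A → ℕ) → ∑ xs (λ x → c * f x) ≡ c * ∑ xs f
    ∑-*ˡ []       c f = sym (*-zeroʳ c)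
    ∑-*ˡ (x ∷ xs) c f =
      trans (cong (c * f x +_) (∑-*ˡ xs c f)) (sym (*-distribˡ-+ c (f x) (∑ xs f)))

    ∑-*ʳ : (xs : List A) (c : ℕ) (f : A → ℕ) → ∑ xs (λ x → f x * c) ≡ ∑ xs f * c
    ∑-*ʳ xs c f =
      trans (∑-cong xs (λ x _ → *-comm (f x) c)) (trans (∑-*ˡ xs c f) (*-comm c (∑ xs f)))

  module _ {A : Set} (xs : List A) (s : A → ℕ) where

    ∑-weighted-+ : (f g : A → ℕ) → ∑ xs (λ x → s x * (f x + g x)) ≡ ∑ xs (λ x → s x * f x) + ∑ xs (λ x → s x * g x)
    ∑-weighted-+ f g = trans (∑-cong xs λ x _ → *-distribˡ-+ (s x) (f x) (g x)) (∑-+ xs _ _)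

    ∑-weighted-* : (c : ℕ) (f : A → ℕ) → ∑ xs (λ x → s x * (c * f x)) ≡ c * ∑ xs (λ x → s x * f x)
    ∑-weighted-* c f = trans (∑-cong xs λ x _ → *-comm-middle (s x) c (f x)) (∑-*ˡ xs c _)
      where
      *-comm-middle : ∀ x y z → x * (y * z) ≡ y * (x * z)
      *-comm-middle x y z = trans (sym (*-assoc x y z)) (trans (cong (_* z) (*-comm x y)) (*-assoc y x z))

  ∑₂ : (ℕ → ℕ → ℕ) → ℕ → ℕ
  ∑₂ f M = ∑ (upTo M) λ j → ∑ (upTo j) λ i → f i j

  ∑₃ : (ℕ → ℕ → ℕ → ℕ) → ℕ → ℕ
  ∑₃ f M = ∑ (upTo M) λ k → ∑₂ (λ i j → f i j k) k

  ∑₂-factor : ∀ M (w : ℕ → ℕ → ℕ) (s f : ℕ → ℕ) → (∀ i j → i < j → j < M → w i j ≡ s j * f i) →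
              ∑₂ w M ≡ ∑ (upTo M) (λ j → s j * ∑ (upTo j) f)
  ∑₂-factor M w s f w≡sf = ∑-cong (upTo M) λ j j∈ →
    trans (∑-cong (upTo j) λ i i∈ → w≡sf i j (∈-upTo⁻ i∈) (∈-upTo⁻ j∈)) (∑-*ˡ (upTo j) (s j) f)

  ∑₃-factor : ∀ M (w : ℕ → ℕ → ℕ → ℕ) (s : ℕ → ℕ) (f : ℕ → ℕ → ℕ) →
              (∀ i j k → i < j → j < k → k < M → w i j k ≡ s k * f i j) →
              ∑₃ w M ≡ ∑ (upTo M) (λ k → s k * ∑₂ f k)
  ∑₃-factor M w s f w≡sf = ∑-cong (upTo M) λ k k∈ →
    trans (∑-cong (upTo k) λ j j∈ →
             trans (∑-cong (upTo j) λ i i∈ → w≡sf i j k (∈-upTo⁻ i∈) (∈-upTo⁻ j∈) (∈-upTo⁻ k∈))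
                   (∑-*ˡ (upTo j) (s k) (λ i → f i j)))
          (∑-*ˡ (upTo k) (s k) (λ j → ∑ (upTo j) λ i → f i j))

  ∑-upTo-suc : (K : ℕ) (f : ℕ → ℕ) → ∑ (upTo (suc K)) f ≡ ∑ (upTo K) f + f K
  ∑-upTo-suc K f = trans (cong (λ l → ∑ l f) (sym (upTo-∷ʳ K)))
    (trans (∑-++ (upTo K) (K ∷ []) f) (cong (∑ (upTo K) f +_) (+-identityʳ (f K))))

module Indicators where
  open import Data.Nat using (_+_; _*_)
  open import Data.Nat.Properties using (≤-refl; *-identityˡ; *-identityʳ; +-identityʳ)
  open import Data.Bool using (if_then_else_)
  open import Data.Empty using (⊥-elim)
  open import Data.Sum using ([_,_])
  open import Data.Product using (proj₁; proj₂)
  open import Relation.Nullary using (does)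
  open import Relation.Binary.Definitions using (DecidableEquality)
  import Data.List.Membership.DecPropositional as DecMembership
  open import Data.List.Membership.Propositional.Properties using (∈-++⁺ˡ; ∈-++⁺ʳ; ∈-++⁻)
  import Data.List.Relation.Unary.All as All
  open import Data.List.Relation.Unary.AllPairs using (_∷_)
  open FiniteSums

  𝟙 : {P : Set} → Dec P → ℕ
  𝟙 d = if does d then 1 else 0

  module _ {P : Set} where

    𝟙-yes : P → (d : Dec P) → 𝟙 d ≡ 1
    𝟙-yes p (yes _) = refl
    𝟙-yes p (no ¬p) = ⊥-elim (¬p p)

    𝟙-no : ¬ P → (d : Dec P) → 𝟙 d ≡ 0
    𝟙-no ¬p (yes p) = ⊥-elim (¬p p)
    𝟙-no ¬p (no _)  = refl

    𝟙≤1 : (d : Dec P) → 𝟙 d ≤ 1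
    𝟙≤1 (yes _) = ≤-refl
    𝟙≤1 (no _)  = z≤n

    𝟙-idem : (d : Dec P) → 𝟙 d * 𝟙 d ≡ 𝟙 d
    𝟙-idem (yes _) = refl
    𝟙-idem (no _)  = refl

    𝟙≡1⇒ : (d : Dec P) → 𝟙 d ≡ 1 → P
    𝟙≡1⇒ (yes p) _ = p

  𝟙-⇔ : {P Q : Set} → (P → Q) → (Q → P) → (p : Dec P) (q : Dec Q) → 𝟙 p ≡ 𝟙 q
  𝟙-⇔ to from (yes p) q = sym (𝟙-yes (to p) q)
  𝟙-⇔ to from (no ¬p) q = sym (𝟙-no (λ x → ¬p (from x)) q)

  module _ {P Q R : Set} where

    𝟙-⊎ : ¬ (P × Q) → (R → P ⊎ Q) → (P ⊎ Q → R) →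
          (r : Dec R) (p : Dec P) (q : Dec Q) → 𝟙 r ≡ 𝟙 p + 𝟙 q
    𝟙-⊎ ¬p×q to from r (yes p) (yes q) = ⊥-elim (¬p×q (p , q))
    𝟙-⊎ ¬p×q to from r (yes p) (no _)  = 𝟙-yes (from (inj₁ p)) r
    𝟙-⊎ ¬p×q to from r (no _)  (yes q) = 𝟙-yes (from (inj₂ q)) r
    𝟙-⊎ ¬p×q to from r (no ¬p) (no ¬q) = 𝟙-no (λ x → [ ¬p , ¬q ] (to x)) r

    𝟙-× : (R → P × Q) → (P × Q → R) → (r : Dec R) (p : Dec P) (q : Dec Q) → 𝟙 r ≡ 𝟙 p * 𝟙 q
    𝟙-× to from r (yes p) (yes q) = 𝟙-yes (from (p , q)) r
    𝟙-× to from r (yes _) (no ¬q) = 𝟙-no (λ x → ¬q (proj₂ (to x))) r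
    𝟙-× to from r (no ¬p) q       = 𝟙-no (λ x → ¬p (proj₁ (to x))) r

  module Membership {A : Set} (_≟_ : DecidableEquality A) where
    open DecMembership _≟_ using (_∈?_)

    𝟙-∈-cong : ∀ {t L M} → (t ∈ L → t ∈ M) → (t ∈ M → t ∈ L) → 𝟙 (t ∈? L) ≡ 𝟙 (t ∈? M)
    𝟙-∈-cong {t} {L} {M} to from = 𝟙-⇔ to from (t ∈? L) (t ∈? M)

    𝟙-∈-++ : ∀ {t L M} → (∀ s → s ∈ L → s ∉ M) → 𝟙 (t ∈? L ++ M) ≡ 𝟙 (t ∈? L) + 𝟙 (t ∈? M)
    𝟙-∈-++ {t} {L} {M} disjoint =
      𝟙-⊎ (λ (p , q) → disjoint t p q) (∈-++⁻ L) [ ∈-++⁺ˡ , ∈-++⁺ʳ L ]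
          (t ∈? L ++ M) (t ∈? L) (t ∈? M)

    𝟙-∈-[_] : ∀ {t} t₀ → 𝟙 (t ∈? t₀ ∷ []) ≡ 𝟙 (t ≟ t₀)
    𝟙-∈-[_] {t} t₀ = 𝟙-⇔ (λ { (here t≡t₀) → t≡t₀ ; (there ()) }) here (t ∈? t₀ ∷ []) (t ≟ t₀)

    𝟙-∈-∷ : ∀ {t t₀ L} → t₀ ∉ L → 𝟙 (t ∈? t₀ ∷ L) ≡ 𝟙 (t ≟ t₀) + 𝟙 (t ∈? L)
    𝟙-∈-∷ {t} {t₀} {L} t₀∉L =
      trans (𝟙-∈-++ {L = t₀ ∷ []} λ { s (here refl) → t₀∉L ; s (there ()) })
            (cong (_+ 𝟙 (t ∈? L)) 𝟙-∈-[ t₀ ])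

    ∑-select : ∀ {xs a} (f : A → ℕ) → Unique xs → a ∈ xs → ∑ xs (λ x → 𝟙 (x ≟ a) * f x) ≡ f a
    ∑-select {y ∷ xs} f (y∉xs ∷ xs!) (here refl) = begin
      𝟙 (y ≟ y) * f y + ∑ xs (λ x → 𝟙 (x ≟ y) * f x)
        ≡⟨ cong₂ _+_ (cong (_* f y) (𝟙-yes refl (y ≟ y)))
                     (∑-zero xs λ x x∈ → cong (_* f x) (𝟙-no (λ { refl → All.lookup y∉xs x∈ refl }) (x ≟ y))) ⟩
      1 * f y + 0  ≡⟨ trans (+-identityʳ _) (*-identityˡ _) ⟩
      f y          ∎
      where open Relation.Binary.PropositionalEquality.≡-Reasoning
    ∑-select {y ∷ xs} f (y∉xs ∷ xs!) (there a∈) =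
      cong₂ _+_ (cong (_* f y) (𝟙-no (λ { refl → All.lookup y∉xs a∈ refl }) (y ≟ _)))
                (∑-select f xs! a∈)

    ∑-𝟙-∈ : ∀ {xs} (T : List A) → Unique xs → Unique T → All (_∈ xs) T →
            ∑ xs (λ x → 𝟙 (x ∈? T)) ≡ length T
    ∑-𝟙-∈ {xs} []      xs! T! T⊆xs = ∑-zero xs λ _ _ → refl
    ∑-𝟙-∈ {xs} (y ∷ T) xs! (y∉T ∷ T!) (y∈xs All.∷ T⊆xs) = begin
      ∑ xs (λ x → 𝟙 (x ∈? y ∷ T))               ≡⟨ ∑-cong xs (λ x _ → 𝟙-∈-∷ y∉T′) ⟩
      ∑ xs (λ x → 𝟙 (x ≟ y) + 𝟙 (x ∈? T))       ≡⟨ ∑-+ xs _ _ ⟩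
      ∑ xs (λ x → 𝟙 (x ≟ y)) + ∑ xs (λ x → 𝟙 (x ∈? T))
        ≡⟨ cong₂ _+_ (trans (∑-cong xs λ x _ → sym (*-identityʳ _)) (∑-select (λ _ → 1) xs! y∈xs))
                     (∑-𝟙-∈ T xs! T! T⊆xs) ⟩
      suc (length T)                             ∎
      where
      open Relation.Binary.PropositionalEquality.≡-Reasoning
      y∉T′ : y ∉ T
      y∉T′ y∈T = All.lookup y∉T y∈T refl

  module _ (S : List ℕ) where
    open DecMembership Data.Nat.Properties._≟_ using (_∈?_)

    χ-idem : ∀ t → χ S t * χ S t ≡ χ S t
    χ-idem t = 𝟙-idem (t ∈? S)

    χ≤1 : ∀ t → χ S t ≤ 1
    χ≤1 t = 𝟙≤1 (t ∈? S)

    χ≡1⇒∈ : ∀ t → χ S t ≡ 1 → t ∈ S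
    χ≡1⇒∈ t = 𝟙≡1⇒ (t ∈? S)

module Triangles where
  open import Data.List using (concatMap)
  open import Data.List.Properties using (concatMap-++; concatMap-cong; concatMap-map)
  open import Data.List.Membership.Propositional using (find; lose)
  open import Data.List.Membership.Propositional.Properties using (∈-concatMap⁺; ∈-concatMap⁻; ∈-upTo⁻)
  open import Data.Product using (∃; ∃₂)

  ⋃₂ : {B : Set} → (ℕ → ℕ → List B) → ℕ → List B
  ⋃₂ G M = concatMap (λ j → concatMap (λ i → G i j) (upTo j)) (upTo M)

  ⋃₃ : {B : Set} → (ℕ → ℕ → ℕ → List B) → ℕ → List B
  ⋃₃ G M = concatMap (λ k → ⋃₂ (λ i j → G i j k) k) (upTo M)

  ∈-concatMap⁻′ : {A B : Set} {F : A → List B} (Q : List A) {t : B} →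
                  t ∈ concatMap F Q → ∃ λ q → q ∈ Q × t ∈ F q
  ∈-concatMap⁻′ Q t∈ = find (∈-concatMap⁻ _ {xs = Q} t∈)

  ∈-concatMap⁺′ : {A B : Set} {F : A → List B} {Q : List A} {q : A} {t : B} →
                  q ∈ Q → t ∈ F q → t ∈ concatMap F Q
  ∈-concatMap⁺′ {F = F} q∈Q t∈Fq = ∈-concatMap⁺ F (lose q∈Q t∈Fq)

  ∈-⋃₂⁻ : {B : Set} {G : ℕ → ℕ → List B} (M : ℕ) {t : B} →
          t ∈ ⋃₂ G M → ∃₂ λ i j → i < j × j < M × t ∈ G i j
  ∈-⋃₂⁻ M t∈ with ∈-concatMap⁻′ (upTo M) t∈
  ... | j , j∈ , t∈′ with ∈-concatMap⁻′ (upTo j) t∈′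
  ...   | i , i∈ , t∈″ = i , j , ∈-upTo⁻ i∈ , ∈-upTo⁻ j∈ , t∈″

  ∈-⋃₃⁻ : {B : Set} {G : ℕ → ℕ → ℕ → List B} (M : ℕ) {t : B} →
          t ∈ ⋃₃ G M → ∃ λ i → ∃₂ λ j k → i < j × j < k × k < M × t ∈ G i j k
  ∈-⋃₃⁻ M t∈ with ∈-concatMap⁻′ (upTo M) t∈
  ... | k , k∈ , t∈′ with ∈-⋃₂⁻ k t∈′
  ...   | i , j , i<j , j<k , t∈″ = i , j , k , i<j , j<k , ∈-upTo⁻ k∈ , t∈″

  ⋃₂-closed : {B : Set} {P : B → Set} {G : ℕ → ℕ → List B} (M : ℕ) →
              (∀ i j → i < j → j < M → ∀ t → t ∈ G i j → P t) → ∀ t → t ∈ ⋃₂ G M → P t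
  ⋃₂-closed M closed t t∈ = let i , j , i<j , j<M , t∈G = ∈-⋃₂⁻ M t∈ in closed i j i<j j<M t t∈G

  ⋃₃-closed : {B : Set} {P : B → Set} {G : ℕ → ℕ → ℕ → List B} (M : ℕ) →
              (∀ i j k → i < j → j < k → k < M → ∀ t → t ∈ G i j k → P t) → ∀ t → t ∈ ⋃₃ G M → P t
  ⋃₃-closed M closed t t∈ = let i , j , k , i<j , j<k , k<M , t∈G = ∈-⋃₃⁻ M t∈ in closed i j k i<j j<k k<M t t∈G

  concatMap-concatMap : {A B C : Set} (f : B → List C) (g : A → List B) (xs : List A) →
                        concatMap f (concatMap g xs) ≡ concatMap (λ x → concatMap f (g x)) xs
  concatMap-concatMap f g []       = refl
  concatMap-concatMap f g (x ∷ xs) =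
    trans (concatMap-++ f (g x) (concatMap g xs)) (cong (concatMap f (g x) ++_) (concatMap-concatMap f g xs))

  concatMap-⋃₂ : {A B : Set} (F : A → List B) (h : ℕ → ℕ → A) (M : ℕ) →
                 concatMap F (concatMap (λ j → map (λ i → h i j) (upTo j)) (upTo M))
                 ≡ ⋃₂ (λ i j → F (h i j)) M
  concatMap-⋃₂ F h M = trans (concatMap-concatMap F _ (upTo M))
    (concatMap-cong (λ j → concatMap-map F _ (upTo j)) (upTo M))

  concatMap-pairs : {B : Set} (F : ℕ × ℕ → List B) (m : ℕ) →
                    concatMap F (pairs m) ≡ ⋃₂ (λ i j → F (i , j)) (suc m)
  concatMap-pairs F m = concatMap-⋃₂ F _,_ (suc m)

  concatMap-triples : {B : Set} (F : Triple → List B) (m : ℕ) →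
                      concatMap F (triples m) ≡ ⋃₃ (λ i j k → F (i , j , k)) (suc m)
  concatMap-triples F m =
    trans (concatMap-concatMap F (λ k → concatMap (λ j → map (λ i → i , j , k) (upTo j)) (upTo k)) (upTo (suc m)))
    (concatMap-cong (λ k → concatMap-⋃₂ F (λ i j → i , j , k) k) (upTo (suc m)))

module Weights (S : List ℕ) (n : ℕ) where
  open import Data.Nat using (_+_; _*_)
  open import Data.Nat.Properties using (_≟_; *-distribʳ-+; *-assoc)
  open import Data.List using (concatMap)
  open import Data.List.Membership.Propositional.Properties using (∈-upTo⁺; ∈-upTo⁻)
  import Data.List.Relation.Unary.All as All
  open import Data.List.Relation.Unary.Unique.Propositional.Properties using (upTo⁺)
  open import Data.List.Relation.Unary.AllPairs using ([]; _∷_)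
  open import Data.Product using (proj₁; proj₂)
  open import Data.Product.Properties using (≡-dec)
  open FiniteSums
  open Triangles
  open Indicators
  open Membership _≟ᵗ_ using (𝟙-∈-cong; 𝟙-∈-++; 𝟙-∈-[_])
  open Membership _≟_ using (∑-select)

  χ³ : Triple → ℕ
  χ³ (x , y , z) = χ S x * χ S y * χ S z

  InCube : Triple → Set
  InCube (x , y , z) = x ≤ n × y ≤ n × z ≤ n

  module _ {x y z x′ y′ z′ : ℕ} where

    ≢-at₁ : x ≢ x′ → (x , y , z) ≢ (x′ , y′ , z′)
    ≢-at₁ x≢x′ refl = x≢x′ refl

    ≢-at₂ : y ≢ y′ → (x , y , z) ≢ (x′ , y′ , z′)
    ≢-at₂ y≢y′ refl = y≢y′ refl

    ≢-at₃ : z ≢ z′ → (x , y , z) ≢ (x′ , y′ , z′)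
    ≢-at₃ z≢z′ refl = z≢z′ refl

  private
    U : List ℕ
    U = upTo (suc n)

    U! : Unique U
    U! = upTo⁺ (suc n)

    ≤n⇒∈U : ∀ {x} → x ≤ n → x ∈ U
    ≤n⇒∈U x≤n = ∈-upTo⁺ (s≤s x≤n)

  sumCube-cong : {F G : ℕ → ℕ → ℕ → ℕ} → (∀ x y z → F x y z ≡ G x y z) → sumCube n F ≡ sumCube n G
  sumCube-cong F≗G = ∑-cong U λ x _ → ∑-cong U λ y _ → ∑-cong U λ z _ → F≗G x y z

  sumCube-+ : (F G : ℕ → ℕ → ℕ → ℕ) →
              sumCube n (λ x y z → F x y z + G x y z) ≡ sumCube n F + sumCube n G
  sumCube-+ F G = trans
    (∑-cong U λ x _ → trans (∑-cong U λ y _ → ∑-+ U (F x y) (G x y))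
                            (∑-+ U (λ y → ∑ U (F x y)) (λ y → ∑ U (G x y))))
    (∑-+ U (λ x → ∑ U λ y → ∑ U (F x y)) (λ x → ∑ U λ y → ∑ U (G x y)))

  𝟙-≟ᵗ : ∀ x y z x₀ y₀ z₀ →
         𝟙 ((x , y , z) ≟ᵗ (x₀ , y₀ , z₀)) ≡ 𝟙 (x ≟ x₀) * (𝟙 (y ≟ y₀) * 𝟙 (z ≟ z₀))
  𝟙-≟ᵗ x y z x₀ y₀ z₀ =
    trans (𝟙-× (λ { refl → refl , refl }) (λ { (refl , refl) → refl })
               ((x , y , z) ≟ᵗ (x₀ , y₀ , z₀)) (x ≟ x₀) ((y , z) ≟yz (y₀ , z₀)))
          (cong (𝟙 (x ≟ x₀) *_) (𝟙-× (λ { refl → refl , refl }) (λ { (refl , refl) → refl })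
               ((y , z) ≟yz (y₀ , z₀)) (y ≟ y₀) (z ≟ z₀)))
    where _≟yz_ = ≡-dec _≟_ _≟_

  sumCube-select : (G : Triple → ℕ) → ∀ {t} → InCube t →
                   sumCube n (λ x y z → 𝟙 ((x , y , z) ≟ᵗ t) * G (x , y , z)) ≡ G t
  sumCube-select G {x₀ , y₀ , z₀} (x₀≤n , y₀≤n , z₀≤n) = begin
    sumCube n (λ x y z → 𝟙 ((x , y , z) ≟ᵗ (x₀ , y₀ , z₀)) * G (x , y , z))
      ≡⟨ sumCube-cong (λ x y z → trans (cong (_* G (x , y , z)) (𝟙-≟ᵗ x y z x₀ y₀ z₀))
                                       (reassoc (δx x) (δy y) (δz z) (G (x , y , z)))) ⟩
    (∑ U λ x → ∑ U λ y → ∑ U λ z → δx x * (δy y * (δz z * G (x , y , z))))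
      ≡⟨ ∑-cong U (λ x _ → trans (∑-cong U λ y _ → ∑-*ˡ U (δx x) λ z → δy y * (δz z * G (x , y , z)))
                                 (∑-*ˡ U (δx x) λ y → ∑ U λ z → δy y * (δz z * G (x , y , z)))) ⟩
    (∑ U λ x → δx x * ∑ U λ y → ∑ U λ z → δy y * (δz z * G (x , y , z)))
      ≡⟨ ∑-select (λ x → ∑ U λ y → ∑ U λ z → δy y * (δz z * G (x , y , z))) U! (≤n⇒∈U x₀≤n) ⟩
    (∑ U λ y → ∑ U λ z → δy y * (δz z * G (x₀ , y , z)))
      ≡⟨ trans (∑-cong U λ y _ → ∑-*ˡ U (δy y) λ z → δz z * G (x₀ , y , z))
               (∑-select (λ y → ∑ U λ z → δz z * G (x₀ , y , z)) U! (≤n⇒∈U y₀≤n)) ⟩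
    (∑ U λ z → δz z * G (x₀ , y₀ , z))
      ≡⟨ ∑-select (λ z → G (x₀ , y₀ , z)) U! (≤n⇒∈U z₀≤n) ⟩
    G (x₀ , y₀ , z₀) ∎
    where
    open Relation.Binary.PropositionalEquality.≡-Reasoning
    δx δy δz : ℕ → ℕ
    δx x = 𝟙 (x ≟ x₀)
    δy y = 𝟙 (y ≟ y₀)
    δz z = 𝟙 (z ≟ z₀)
    reassoc : ∀ p q r g → p * (q * r) * g ≡ p * (q * (r * g))
    reassoc p q r g = trans (*-assoc p (q * r) g) (cong (p *_) (*-assoc q r g))

  weight-cong : ∀ {L M} → (∀ t → t ∈ L → t ∈ M) → (∀ t → t ∈ M → t ∈ L) → weight S n L ≡ weight S n M
  weight-cong L⊆M M⊆L = sumCube-cong λ x y z → cong (_* χ³ (x , y , z)) (𝟙-∈-cong (L⊆M _) (M⊆L _))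

  weight-++ : ∀ L M → (∀ t → t ∈ L → t ∉ M) → weight S n (L ++ M) ≡ weight S n L + weight S n M
  weight-++ L M disjoint = trans
    (sumCube-cong λ x y z → trans (cong (_* χ³ (x , y , z)) (𝟙-∈-++ disjoint))
                                  (*-distribʳ-+ (χ³ (x , y , z)) [ (x , y , z) ∈ᵗ L ] [ (x , y , z) ∈ᵗ M ]))
    (sumCube-+ (λ x y z → [ (x , y , z) ∈ᵗ L ] * χ³ (x , y , z)) (λ x y z → [ (x , y , z) ∈ᵗ M ] * χ³ (x , y , z)))

  weight-[] : weight S n [] ≡ 0
  weight-[] = ∑-zero U λ x _ → ∑-zero U λ y _ → ∑-zero U λ z _ → refl

  weight-[_] : ∀ {t} → InCube t → weight S n (t ∷ []) ≡ χ³ t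
  weight-[_] {t} t∈cube =
    trans (sumCube-cong λ x y z → cong (_* χ³ (x , y , z)) (𝟙-∈-[_] {x , y , z} t)) (sumCube-select χ³ t∈cube)

  weight-distinct : ∀ {L} → Unique L → All InCube L → weight S n L ≡ ∑ L χ³
  weight-distinct {[]}    []          All.[]             = weight-[]
  weight-distinct {t ∷ L} (t∉L ∷ L!) (t∈cube All.∷ L⊆cube) =
    trans (weight-++ (t ∷ []) L λ { s (here refl) s∈L → All.lookup t∉L s∈L refl ; s (there ()) })
          (cong₂ _+_ weight-[ t∈cube ] (weight-distinct L! L⊆cube))

  weight-twice : ∀ {p p′} → p′ ≡ p → InCube p → weight S n (p ∷ p′ ∷ []) ≡ χ³ p + 0
  weight-twice {p} refl p∈cube = trans
    (weight-cong {p ∷ p ∷ []} {p ∷ []}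
                 (λ { _ (here refl) → here refl ; _ (there (here refl)) → here refl ; _ (there (there ())) })
                 (λ { _ (here refl) → here refl ; _ (there ()) }))
    (weight-distinct (All.[] ∷ []) (p∈cube All.∷ All.[]))

  weight-doubled : ∀ {p p′ q q′} → p′ ≡ p → q′ ≡ q → p ≢ q → InCube p → InCube q →
                   weight S n (p ∷ p′ ∷ q ∷ q′ ∷ []) ≡ χ³ p + (χ³ q + 0)
  weight-doubled {p} {_} {q} refl refl p≢q p∈cube q∈cube = trans
    (weight-cong {p ∷ p ∷ q ∷ q ∷ []} {p ∷ q ∷ []}
                 (λ { _ (here refl) → here refl ; _ (there (here refl)) → here refl
                    ; _ (there (there (here refl))) → there (here refl)
                    ; _ (there (there (there (here refl)))) → there (here refl)
                    ; _ (there (there (there (there ())))) })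
                 (λ { _ (here refl) → here refl ; _ (there (here refl)) → there (there (here refl))
                    ; _ (there (there ())) }))
    (weight-distinct ((p≢q All.∷ All.[]) ∷ All.[] ∷ []) (p∈cube All.∷ q∈cube All.∷ All.[]))

  weight-concatMap : {A : Set} (F : A → List Triple) (label : Triple → A) {Q : List A} → Unique Q →
                     (∀ q → q ∈ Q → ∀ t → t ∈ F q → label t ≡ q) →
                     weight S n (concatMap F Q) ≡ ∑ Q (λ q → weight S n (F q))
  weight-concatMap F label {[]}    []          labelled = weight-[]
  weight-concatMap F label {q ∷ Q} (q∉Q ∷ Q!) labelled =
    trans (weight-++ (F q) (concatMap F Q) disjoint)
          (cong (weight S n (F q) +_) (weight-concatMap F label Q! λ q′ q′∈ → labelled q′ (there q′∈)))
    where
    disjoint : ∀ t → t ∈ F q → t ∉ concatMap F Q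
    disjoint t t∈Fq t∈FQ with ∈-concatMap⁻′ Q t∈FQ
    ... | q′ , q′∈Q , t∈Fq′ =
      All.lookup q∉Q q′∈Q (trans (sym (labelled q (here refl) t t∈Fq)) (labelled q′ (there q′∈Q) t t∈Fq′))

  weight-⋃₂ : (G : ℕ → ℕ → List Triple) (M : ℕ) (dj di : Triple → ℕ) →
              (∀ i j → i < j → j < M → ∀ t → t ∈ G i j → dj t ≡ j × di t ≡ i) →
              weight S n (⋃₂ G M) ≡ ∑₂ (λ i j → weight S n (G i j)) M
  weight-⋃₂ G M dj di labelled = trans
    (weight-concatMap _ dj (upTo⁺ M) λ j j∈ t t∈ →
      let i , i∈ , t∈′ = ∈-concatMap⁻′ (upTo j) t∈ in
      proj₁ (labelled i j (∈-upTo⁻ i∈) (∈-upTo⁻ j∈) t t∈′))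
    (∑-cong (upTo M) λ j j∈ → weight-concatMap _ di (upTo⁺ j) λ i i∈ t t∈ →
      proj₂ (labelled i j (∈-upTo⁻ i∈) (∈-upTo⁻ j∈) t t∈))

  weight-⋃₃ : (G : ℕ → ℕ → ℕ → List Triple) (M : ℕ) (dk dj di : Triple → ℕ) →
              (∀ i j k → i < j → j < k → k < M → ∀ t → t ∈ G i j k → dk t ≡ k × dj t ≡ j × di t ≡ i) →
              weight S n (⋃₃ G M) ≡ ∑₃ (λ i j k → weight S n (G i j k)) M
  weight-⋃₃ G M dk dj di labelled = trans
    (weight-concatMap _ dk (upTo⁺ M) λ k k∈ t t∈ →
      let i , j , i<j , j<k , t∈′ = ∈-⋃₂⁻ k t∈ in
      proj₁ (labelled i j k i<j j<k (∈-upTo⁻ k∈) t t∈′))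
    (∑-cong (upTo M) λ k k∈ → weight-⋃₂ (λ i j → G i j k) k dj di λ i j i<j j<k t t∈ →
      proj₂ (labelled i j k i<j j<k (∈-upTo⁻ k∈) t t∈))

module SumsOfProducts where
  open import Data.Nat using (_+_; _*_; _∸_)
  open import Data.Nat.Properties using (≤-total; m≤m+n; m+[n∸m]≡n; *-comm; +-comm)
  open import Data.Nat.Tactic.RingSolver using (solve-∀)
  open import Relation.Binary.PropositionalEquality using (subst₂; module ≡-Reasoning)
  open FiniteSums

  ∑₂-+ : (f g : ℕ → ℕ → ℕ) (K : ℕ) → ∑₂ (λ i j → f i j + g i j) K ≡ ∑₂ f K + ∑₂ g K
  ∑₂-+ f g K = trans (∑-cong (upTo K) λ j _ → ∑-+ (upTo j) (λ i → f i j) (λ i → g i j))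
                     (∑-+ (upTo K) (λ j → ∑ (upTo j) λ i → f i j) (λ j → ∑ (upTo j) λ i → g i j))

  module _ (a b : ℕ → ℕ) where

    ∑₂-cross : ∀ K → ∑₂ (λ i j → a i * b j + a j * b i) K + ∑ (upTo K) (λ i → a i * b i)
                     ≡ ∑ (upTo K) a * ∑ (upTo K) b
    ∑₂-cross zero    = refl
    ∑₂-cross (suc K) = begin
      P (suc K) + ∑ (upTo (suc K)) (λ i → a i * b i)
        ≡⟨ cong₂ _+_ (trans (∑-upTo-suc K _) (cong (P K +_) new-pairs)) (∑-upTo-suc K _) ⟩
      P K + (α * b K + a K * β) + (∑ (upTo K) (λ i → a i * b i) + a K * b K)
        ≡⟨ regroup (P K) (∑ (upTo K) (λ i → a i * b i)) (α * b K + a K * β) (a K * b K) ⟩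
      (P K + ∑ (upTo K) (λ i → a i * b i)) + (α * b K + a K * β + a K * b K)
        ≡⟨ cong (_+ (α * b K + a K * β + a K * b K)) (∑₂-cross K) ⟩
      α * β + (α * b K + a K * β + a K * b K)
        ≡⟨ expand α β (a K) (b K) ⟩
      (α + a K) * (β + b K)
        ≡⟨ sym (cong₂ _*_ (∑-upTo-suc K a) (∑-upTo-suc K b)) ⟩
      ∑ (upTo (suc K)) a * ∑ (upTo (suc K)) b ∎
      where
      open ≡-Reasoning
      P = ∑₂ (λ i j → a i * b j + a j * b i)
      α = ∑ (upTo K) a
      β = ∑ (upTo K) b
      new-pairs : ∑ (upTo K) (λ i → a i * b K + a K * b i) ≡ α * b K + a K * β
      new-pairs = trans (∑-+ (upTo K) (λ i → a i * b K) (λ i → a K * b i))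
                        (cong₂ _+_ (∑-*ʳ (upTo K) (b K) a) (∑-*ˡ (upTo K) (a K) b))
      regroup : ∀ p g x y → p + x + (g + y) ≡ (p + g) + (x + y)
      regroup = solve-∀
      expand : ∀ α β x y → α * β + (α * y + x * β + x * y) ≡ (α + x) * (β + y)
      expand = solve-∀

  ∑₂-square : (a : ℕ → ℕ) → (∀ x → a x * a x ≡ a x) →
              ∀ K → 2 * ∑₂ (λ i j → a i * a j) K + ∑ (upTo K) a ≡ ∑ (upTo K) a * ∑ (upTo K) a
  ∑₂-square a idem zero    = refl
  ∑₂-square a idem (suc K) = begin
    2 * P (suc K) + ∑ (upTo (suc K)) a
      ≡⟨ cong₂ (λ x y → 2 * x + y) (trans (∑-upTo-suc K _) (cong (P K +_) (∑-*ʳ (upTo K) (a K) a)))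
                                   (∑-upTo-suc K a) ⟩
    2 * (P K + α * a K) + (α + a K)
      ≡⟨ regroup (P K) α (a K) ⟩
    (2 * P K + α) + 2 * (α * a K) + a K
      ≡⟨ cong₂ (λ x y → x + 2 * (α * a K) + y) (∑₂-square a idem K) (sym (idem K)) ⟩
    α * α + 2 * (α * a K) + a K * a K
      ≡⟨ expand α (a K) ⟩
    (α + a K) * (α + a K)
      ≡⟨ sym (cong (λ x → x * x) (∑-upTo-suc K a)) ⟩
    ∑ (upTo (suc K)) a * ∑ (upTo (suc K)) a ∎
    where
    open ≡-Reasoning
    P = ∑₂ (λ i j → a i * a j)
    α = ∑ (upTo K) a
    regroup : ∀ p α x → 2 * (p + α * x) + (α + x) ≡ (2 * p + α) + 2 * (α * x) + x
    regroup = solve-∀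
    expand : ∀ α x → α * α + 2 * (α * x) + x * x ≡ (α + x) * (α + x)
    expand = solve-∀

  2xy≤x²+y²-ordered : ∀ x d → 2 * (x * (x + d)) ≤ x * x + (x + d) * (x + d)
  2xy≤x²+y²-ordered x d = subst (2 * (x * (x + d)) ≤_) (sym (square-gap x d)) (m≤m+n _ (d * d))
    where
    square-gap : ∀ x d → x * x + (x + d) * (x + d) ≡ 2 * (x * (x + d)) + d * d
    square-gap = solve-∀

  2xy≤x²+y² : ∀ x y → 2 * (x * y) ≤ x * x + y * y
  2xy≤x²+y² x y with ≤-total x y
  ... | inj₁ x≤y = subst (λ y → 2 * (x * y) ≤ x * x + y * y) (m+[n∸m]≡n x≤y) (2xy≤x²+y²-ordered x (y ∸ x))
  ... | inj₂ y≤x = subst₂ _≤_ (cong (2 *_) (*-comm y x)) (+-comm (y * y) (x * x))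
                     (subst (λ x → 2 * (y * x) ≤ y * y + x * x) (m+[n∸m]≡n y≤x) (2xy≤x²+y²-ordered y (x ∸ y)))

module CountingInequality (σ : ℕ → ℕ) (σ≤2 : ∀ k → σ k ≤ 2) where
  open import Data.Nat using (_+_; _*_)
  open import Data.Nat.Properties
    using (_≟_; ≤-refl; ≤-trans; <-irrefl; n≤1+n; m≤m+n; +-mono-≤; +-identityʳ)
  open import Data.Empty using (⊥-elim)
  open import Relation.Binary.PropositionalEquality using (subst₂)
  open import Data.Nat.Tactic.RingSolver using (solve-∀)
  open FiniteSums

  ρ B W : ℕ → ℕ
  ρ K = ∑ (upTo K) σ
  B K = ∑ (upTo K) λ k → σ k * ρ k
  W K = ∑ (upTo K) λ k → σ k * (ρ k * ρ k)

  private
    lhs rhs : ℕ → ℕ → ℕ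
    lhs b r = 12 * b + 2 * (r * r * r)
    rhs w r = 6 * w + 9 * (r * r) + 14 * r

  -- A step with σ k ≤ 1 preserves both Bound and Bound⁺ (which has 12ρ to spare), while a step
  -- with σ k = 2 only turns Bound⁺ into Bound: hence σ k = 2 may occur at most once.
  Bound Bound⁺ : ℕ → Set
  Bound K = lhs (B K) (ρ K) ≤ rhs (W K) (ρ K)
  Bound⁺ K = lhs (B K) (ρ K) + 12 * ρ K ≤ rhs (W K) (ρ K)

  private
    BoundAfter Bound⁺After : ℕ → ℕ → ℕ → ℕ → Set
    BoundAfter b w r s = lhs (b + s * r) (r + s) ≤ rhs (w + s * (r * r)) (r + s)
    Bound⁺After b w r s = lhs (b + s * r) (r + s) + 12 * (r + s) ≤ rhs (w + s * (r * r)) (r + s)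

    grow : ∀ {x y p q x′ y′} → x ≤ y → p ≤ q → x′ ≡ x + p → y′ ≡ y + q → x′ ≤ y′
    grow x≤y p≤q refl refl = +-mono-≤ x≤y p≤q

    bound₀ : ∀ {b w r} → lhs b r ≤ rhs w r → BoundAfter b w r 0
    bound₀ {b} {w} {r} = subst₂ _≤_ (cong₂ lhs (sym (+-identityʳ b)) (sym (+-identityʳ r)))
                                    (cong₂ rhs (sym (+-identityʳ w)) (sym (+-identityʳ r)))

    bound⁺₀ : ∀ {b w r} → lhs b r + 12 * r ≤ rhs w r → Bound⁺After b w r 0
    bound⁺₀ {b} {w} {r} = subst₂ _≤_ (cong₂ (λ b r → lhs b r + 12 * r) (sym (+-identityʳ b)) (sym (+-identityʳ r)))
                                     (cong₂ rhs (sym (+-identityʳ w)) (sym (+-identityʳ r)))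

    bound₁ : ∀ {b w r} → lhs b r ≤ rhs w r → BoundAfter b w r 1
    bound₁ {b} {w} {r} h = grow h (m≤m+n _ 21) (left b r) (right w r)
      where
      left : ∀ b r → 12 * (b + 1 * r) + 2 * ((r + 1) * (r + 1) * (r + 1))
                     ≡ (12 * b + 2 * (r * r * r)) + (6 * (r * r) + 18 * r + 2)
      left = solve-∀
      right : ∀ w r → 6 * (w + 1 * (r * r)) + 9 * ((r + 1) * (r + 1)) + 14 * (r + 1)
                      ≡ (6 * w + 9 * (r * r) + 14 * r) + (6 * (r * r) + 18 * r + 2 + 21)
      right = solve-∀

    bound⁺₁ : ∀ {b w r} → lhs b r + 12 * r ≤ rhs w r → Bound⁺After b w r 1
    bound⁺₁ {b} {w} {r} h = grow h (m≤m+n _ 9) (left b r) (right w r)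
      where
      left : ∀ b r → 12 * (b + 1 * r) + 2 * ((r + 1) * (r + 1) * (r + 1)) + 12 * (r + 1)
                     ≡ (12 * b + 2 * (r * r * r) + 12 * r) + (6 * (r * r) + 18 * r + 14)
      left = solve-∀
      right : ∀ w r → 6 * (w + 1 * (r * r)) + 9 * ((r + 1) * (r + 1)) + 14 * (r + 1)
                      ≡ (6 * w + 9 * (r * r) + 14 * r) + (6 * (r * r) + 18 * r + 14 + 9)
      right = solve-∀

    bound₂ : ∀ {b w r} → lhs b r + 12 * r ≤ rhs w r → BoundAfter b w r 2
    bound₂ {b} {w} {r} h = grow h (m≤m+n _ 48) (left b r) (right w r)
      where
      left : ∀ b r → 12 * (b + 2 * r) + 2 * ((r + 2) * (r + 2) * (r + 2))
                     ≡ (12 * b + 2 * (r * r * r) + 12 * r) + (12 * (r * r) + 36 * r + 16)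
      left = solve-∀
      right : ∀ w r → 6 * (w + 2 * (r * r)) + 9 * ((r + 2) * (r + 2)) + 14 * (r + 2)
                      ≡ (6 * w + 9 * (r * r) + 14 * r) + (12 * (r * r) + 36 * r + 16 + 48)
      right = solve-∀

    ≤2-cases : ∀ {s} → s ≤ 2 → s ≡ 0 ⊎ s ≡ 1 ⊎ s ≡ 2
    ≤2-cases z≤n             = inj₁ refl
    ≤2-cases (s≤s z≤n)       = inj₂ (inj₁ refl)
    ≤2-cases (s≤s (s≤s z≤n)) = inj₂ (inj₂ refl)

    lhs-suc : ∀ K → lhs (B (suc K)) (ρ (suc K)) ≡ lhs (B K + σ K * ρ K) (ρ K + σ K)
    lhs-suc K = cong₂ lhs (∑-upTo-suc K _) (∑-upTo-suc K σ)

    rhs-suc : ∀ K → rhs (W (suc K)) (ρ (suc K)) ≡ rhs (W K + σ K * (ρ K * ρ K)) (ρ K + σ K)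
    rhs-suc K = cong₂ rhs (∑-upTo-suc K _) (∑-upTo-suc K σ)

    Bound-suc : ∀ K → BoundAfter (B K) (W K) (ρ K) (σ K) → Bound (suc K)
    Bound-suc K = subst₂ _≤_ (sym (lhs-suc K)) (sym (rhs-suc K))

    Bound⁺-suc : ∀ K → Bound⁺After (B K) (W K) (ρ K) (σ K) → Bound⁺ (suc K)
    Bound⁺-suc K =
      subst₂ _≤_ (sym (cong₂ _+_ (lhs-suc K) (cong (12 *_) (∑-upTo-suc K σ)))) (sym (rhs-suc K))

  bound-step : ∀ K → σ K ≢ 2 → Bound K → Bound (suc K)
  bound-step K σK≢2 h with ≤2-cases (σ≤2 K)
  ... | inj₁ σK≡0        = Bound-suc K
      (subst (BoundAfter (B K) (W K) (ρ K)) (sym σK≡0) (bound₀ {B K} {W K} {ρ K} h))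
  ... | inj₂ (inj₁ σK≡1) = Bound-suc K
      (subst (BoundAfter (B K) (W K) (ρ K)) (sym σK≡1) (bound₁ {B K} {W K} {ρ K} h))
  ... | inj₂ (inj₂ σK≡2) = ⊥-elim (σK≢2 σK≡2)

  bound⁺-step : ∀ K → σ K ≢ 2 → Bound⁺ K → Bound⁺ (suc K)
  bound⁺-step K σK≢2 h with ≤2-cases (σ≤2 K)
  ... | inj₁ σK≡0        = Bound⁺-suc K
      (subst (Bound⁺After (B K) (W K) (ρ K)) (sym σK≡0) (bound⁺₀ {B K} {W K} {ρ K} h))
  ... | inj₂ (inj₁ σK≡1) = Bound⁺-suc K
      (subst (Bound⁺After (B K) (W K) (ρ K)) (sym σK≡1) (bound⁺₁ {B K} {W K} {ρ K} h))
  ... | inj₂ (inj₂ σK≡2) = ⊥-elim (σK≢2 σK≡2)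

  bound⁺⇒bound-step : ∀ K → Bound⁺ K → Bound (suc K)
  bound⁺⇒bound-step K h with σ K ≟ 2
  ... | yes σK≡2 = Bound-suc K
      (subst (BoundAfter (B K) (W K) (ρ K)) (sym σK≡2) (bound₂ {B K} {W K} {ρ K} h))
  ... | no  σK≢2 = bound-step K σK≢2 (≤-trans (m≤m+n _ _) h)

  bound⁺ : ∀ K → (∀ k → k < K → σ k ≢ 2) → Bound⁺ K
  bound⁺ zero    _   = z≤n
  bound⁺ (suc K) no2 = bound⁺-step K (no2 K ≤-refl) (bound⁺ K λ k k<K → no2 k (≤-trans k<K (n≤1+n K)))

  bound : ∀ M → (∀ k k′ → k < M → k′ < M → σ k ≡ 2 → σ k′ ≡ 2 → k ≡ k′) → ∀ K → K ≤ M → Bound K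
  bound M two-once zero    _   = z≤n
  bound M two-once (suc K) K<M with σ K ≟ 2
  ... | no  σK≢2 = bound-step K σK≢2 (bound M two-once K (≤-trans (n≤1+n K) K<M))
  ... | yes σK≡2 = bound⁺⇒bound-step K (bound⁺ K λ k k<K σk≡2 →
                     <-irrefl (two-once k K (≤-trans k<K (≤-trans (n≤1+n K) K<M)) K<M σk≡2 σK≡2) k<K)

module Folding (n : ℕ) where
  open import Data.Nat using (_+_; _*_; _∸_; _⊓_; _⊔_)
  open import Data.Nat.Properties
    using (_≤?_; ≤-refl; ≤-trans; ≤-pred; <⇒≤; <⇒≢; <-trans; <-≤-trans; <-irrefl; ≰⇒>; +-mono-≤; +-mono-<-≤;
           m≤m+n; m∸n≤m; ∸-monoˡ-≤; ∸-monoʳ-≤; m+n∸n≡m; m∸[m∸n]≡n; m≤n+o⇒m∸n≤o; m≤n⇒m⊓n≡m; m≥n⇒m⊓n≡n;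
           m≤n⇒m⊔n≡n; m≥n⇒m⊔n≡m; m≤n⇒m<n∨m≡n)
  open import Data.List using (concatMap)
  open import Data.List.Membership.Propositional.Properties using (∈-upTo⁺; ∈-upTo⁻)
  open import Data.Product using (proj₁)
  open import Data.Nat.DivMod using (m/n*n≤m; m%n<n; m≡m%n+[m/n]*n)
  open import Data.Nat.Tactic.RingSolver using (solve-∀)
  open import Relation.Binary.PropositionalEquality using (subst₂)
  open import Data.Empty using (⊥-elim)
  import Data.List.Relation.Unary.All as All
  open Triangles

  m M : ℕ
  m = half n
  M = suc m

  m+m≤n : m + m ≤ n
  m+m≤n = subst (_≤ n) (double m) (m/n*n≤m n 2)
    where
    double : ∀ q → q * 2 ≡ q + q
    double = solve-∀

  n≤M+m : n ≤ M + m
  n≤M+m = subst (_≤ M + m) (sym (m≡m%n+[m/n]*n n 2))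
    (subst (n % 2 + m * 2 ≤_) (double+1 m) (+-mono-≤ (≤-pred (m%n<n n 2)) ≤-refl))
    where
    open Data.Nat using (_%_)
    double+1 : ∀ q → 1 + q * 2 ≡ suc q + q
    double+1 = solve-∀

  -- Folding the coordinates of any member of a block below recovers the block's index (as
  -- fold-min, fold-mid and fold-max, in some order), so distinct blocks are disjoint.
  fold : ℕ → ℕ
  fold x = x ⊓ (n ∸ x)

  module _ {v : ℕ} (v≤m : v ≤ m) where

    ≤n : v ≤ n
    ≤n = ≤-trans v≤m (≤-trans (m≤m+n m m) m+m≤n)

    ≤mirror : v ≤ n ∸ v
    ≤mirror = subst (_≤ n ∸ v) (m+n∸n≡m v v) (∸-monoˡ-≤ v (≤-trans (+-mono-≤ v≤m v≤m) m+m≤n))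

    fold-low : fold v ≡ v
    fold-low = m≤n⇒m⊓n≡m ≤mirror

    fold-high : fold (n ∸ v) ≡ v
    fold-high = trans (cong ((n ∸ v) ⊓_) (m∸[m∸n]≡n ≤n)) (m≥n⇒m⊓n≡n ≤mirror)

  mirror≤n : ∀ v → n ∸ v ≤ n
  mirror≤n v = m∸n≤m n v

  <mirror : ∀ {i k} → i < k → k ≤ m → i ≢ n ∸ k
  <mirror i<k k≤m = <⇒≢ (<-≤-trans i<k (≤mirror k≤m))

  fold-max fold-mid fold-min : Triple → ℕ
  fold-max (x , y , z) = fold x ⊔ fold z
  fold-mid (x , y , z) = fold y
  fold-min (x , y , z) = fold x ⊓ fold z

  FoldsTo : ℕ → ℕ → ℕ → Triple → Set
  FoldsTo hi mid lo t = fold-max t ≡ hi × fold-mid t ≡ mid × fold-min t ≡ lo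

  folds-to : ∀ {x y z p q r} → fold x ≡ p → fold y ≡ q → fold z ≡ r → p ≤ r → FoldsTo r q p (x , y , z)
  folds-to refl refl refl p≤r = m≤n⇒m⊔n≡n p≤r , refl , m≤n⇒m⊓n≡m p≤r

  folds-to-rev : ∀ {x y z p q r} → fold x ≡ r → fold y ≡ q → fold z ≡ p → p ≤ r → FoldsTo r q p (x , y , z)
  folds-to-rev refl refl refl p≤r = m≥n⇒m⊔n≡m p≤r , refl , m≥n⇒m⊓n≡n p≤r

  blockA blockA′ : ℕ → ℕ → ℕ → List Triple
  blockA  i j k = (i , j , k) ∷ (i , j , n ∸ k) ∷ (k , n ∸ j , n ∸ i) ∷ (n ∸ k , n ∸ j , n ∸ i) ∷ []
  blockA′ i j k = (i , k , n ∸ j) ∷ (i , n ∸ k , n ∸ j) ∷ (j , n ∸ k , n ∸ i) ∷ (j , k , n ∸ i) ∷ []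

  blockB blockB′ : ℕ → ℕ → List Triple
  blockB  i j = (i , i , j) ∷ (i , i , n ∸ j) ∷ (j , n ∸ i , n ∸ i) ∷ (n ∸ j , n ∸ i , n ∸ i) ∷ []
  blockB′ i j = (i , j , n ∸ i) ∷ (i , n ∸ j , n ∸ i) ∷ []

  diagonal : ℕ → Triple
  diagonal x = x , x , x

  blockD : ℕ → List Triple
  blockD v = diagonal v ∷ diagonal (n ∸ v) ∷ []

  diagonals : List Triple
  diagonals = concatMap (λ x → diagonal x ∷ []) (upTo (suc n))

  blockD-folds : ∀ v → v ∈ upTo M → ∀ t → t ∈ blockD v → fold (proj₁ t) ≡ v
  blockD-folds v v∈ _ (here refl)         = fold-low (≤-pred (∈-upTo⁻ v∈))
  blockD-folds v v∈ _ (there (here refl)) = fold-high (≤-pred (∈-upTo⁻ v∈))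

  ∈-diagonals : ∀ {x} → x ≤ n → diagonal x ∈ diagonals
  ∈-diagonals x≤n = ∈-concatMap⁺′ {F = λ x → diagonal x ∷ []} (∈-upTo⁺ (s≤s x≤n)) (here refl)

  diagonals⊆blocks : ∀ t → t ∈ diagonals → t ∈ concatMap blockD (upTo M)
  diagonals⊆blocks t t∈ with ∈-concatMap⁻′ {F = λ x → diagonal x ∷ []} (upTo (suc n)) t∈
  ... | x , x∈ , here refl with x ≤? m
  ...   | yes x≤m = ∈-concatMap⁺′ {F = blockD} (∈-upTo⁺ (s≤s x≤m)) (here refl)
  ...   | no  x≰m = ∈-concatMap⁺′ {F = blockD} (∈-upTo⁺ (s≤s x̄≤m))
                      (there (here (cong diagonal (sym (m∸[m∸n]≡n (≤-pred (∈-upTo⁻ x∈)))))))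
    where
    x̄≤m : n ∸ x ≤ m
    x̄≤m = ≤-trans (∸-monoʳ-≤ n (≰⇒> x≰m)) (m≤n+o⇒m∸n≤o n M n≤M+m)

  blocks⊆diagonals : ∀ t → t ∈ concatMap blockD (upTo M) → t ∈ diagonals
  blocks⊆diagonals t t∈ with ∈-concatMap⁻′ {F = blockD} (upTo M) t∈
  ... | v , v∈ , here refl         = ∈-diagonals (≤n (≤-pred (∈-upTo⁻ v∈)))
  ... | v , v∈ , there (here refl) = ∈-diagonals (mirror≤n v)

  module _ {i j k : ℕ} (i<j : i < j) (j<k : j < k) (k≤m : k ≤ m) where
    private
      j≤m = ≤-trans (<⇒≤ j<k) k≤m
      i≤m = ≤-trans (<⇒≤ i<j) j≤m
      i<k = <-trans i<j j<k

    blockA-folds : All (FoldsTo k j i) (blockA i j k)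
    blockA-folds =
        folds-to (fold-low i≤m) (fold-low j≤m) (fold-low k≤m) (<⇒≤ i<k)
      All.∷ folds-to (fold-low i≤m) (fold-low j≤m) (fold-high k≤m) (<⇒≤ i<k)
      All.∷ folds-to-rev (fold-low k≤m) (fold-high j≤m) (fold-high i≤m) (<⇒≤ i<k)
      All.∷ folds-to-rev (fold-high k≤m) (fold-high j≤m) (fold-high i≤m) (<⇒≤ i<k)
      All.∷ All.[]

    blockA′-folds : All (FoldsTo j k i) (blockA′ i j k)
    blockA′-folds =
        folds-to (fold-low i≤m) (fold-low k≤m) (fold-high j≤m) (<⇒≤ i<j)
      All.∷ folds-to (fold-low i≤m) (fold-high k≤m) (fold-high j≤m) (<⇒≤ i<j)
      All.∷ folds-to-rev (fold-low j≤m) (fold-high k≤m) (fold-high i≤m) (<⇒≤ i<j)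
      All.∷ folds-to-rev (fold-low j≤m) (fold-low k≤m) (fold-high i≤m) (<⇒≤ i<j)
      All.∷ All.[]

  module _ {i j : ℕ} (i<j : i < j) (j≤m : j ≤ m) where
    private
      i≤m = ≤-trans (<⇒≤ i<j) j≤m

    blockB-folds : All (FoldsTo j i i) (blockB i j)
    blockB-folds =
        folds-to (fold-low i≤m) (fold-low i≤m) (fold-low j≤m) (<⇒≤ i<j)
      All.∷ folds-to (fold-low i≤m) (fold-low i≤m) (fold-high j≤m) (<⇒≤ i<j)
      All.∷ folds-to-rev (fold-low j≤m) (fold-high i≤m) (fold-high i≤m) (<⇒≤ i<j)
      All.∷ folds-to-rev (fold-high j≤m) (fold-high i≤m) (fold-high i≤m) (<⇒≤ i<j)
      All.∷ All.[]

    blockB′-folds : All (FoldsTo i j i) (blockB′ i j)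
    blockB′-folds =
        folds-to (fold-low i≤m) (fold-low j≤m) (fold-high i≤m) ≤-refl
      All.∷ folds-to (fold-low i≤m) (fold-high j≤m) (fold-high i≤m) ≤-refl
      All.∷ All.[]

  𝒜≡⋃₃ : 𝒜 n ≡ ⋃₃ blockA M
  𝒜≡⋃₃ = concatMap-triples _ m

  𝒜′≡⋃₃ : 𝒜′ n ≡ ⋃₃ blockA′ M
  𝒜′≡⋃₃ = concatMap-triples _ m

  ℬ≡⋃₂ : ℬ n ≡ ⋃₂ blockB M
  ℬ≡⋃₂ = concatMap-pairs _ m

  ℬ′≡⋃₂ : ℬ′ n ≡ ⋃₂ blockB′ M
  ℬ′≡⋃₂ = concatMap-pairs _ m

  𝒜′-folds-apart : ∀ t → t ∈ 𝒜′ n → fold-min t < fold-max t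
  𝒜′-folds-apart t t∈𝒜′ = ⋃₃-closed M (λ i j k i<j j<k k<M t t∈A →
      let max≡j , _ , min≡i = All.lookup (blockA′-folds i<j j<k (≤-pred k<M)) t∈A in
      subst₂ _<_ (sym min≡i) (sym max≡j) i<j)
    t (subst (t ∈_) 𝒜′≡⋃₃ t∈𝒜′)

  ℬ′-folds-together : ∀ t → t ∈ ℬ′ n → fold-min t ≡ fold-max t
  ℬ′-folds-together t t∈ℬ′ = ⋃₂-closed M (λ i j i<j j<M t t∈B →
      let max≡i , _ , min≡i = All.lookup (blockB′-folds i<j (≤-pred j<M)) t∈B in
      trans min≡i (sym max≡i))
    t (subst (t ∈_) ℬ′≡⋃₂ t∈ℬ′)

  𝒜′-ℬ′-disjoint : ∀ t → t ∈ 𝒜′ n → t ∉ ℬ′ n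
  𝒜′-ℬ′-disjoint t t∈𝒜′ t∈ℬ′ = <⇒≢ (𝒜′-folds-apart t t∈𝒜′) (ℬ′-folds-together t t∈ℬ′)

  ≤m-sum≡n⇒≡m : ∀ {k k′} → k ≤ m → k′ ≤ m → k + k′ ≡ n → k ≡ m
  ≤m-sum≡n⇒≡m {k} {k′} k≤m k′≤m k+k′≡n with m≤n⇒m<n∨m≡n k≤m
  ... | inj₂ k≡m = k≡m
  ... | inj₁ k<m = ⊥-elim (<-irrefl k+k′≡n (<-≤-trans (+-mono-<-≤ k<m k′≤m) m+m≤n))

module BlockWeights (S : List ℕ) (n : ℕ) where
  open import Data.Nat using (_+_; _*_; _∸_)
  open import Data.Nat.Properties
    using (_≟_; ≤-trans; ≤-pred; <⇒≤; <⇒≢; <-trans; m+[n∸m]≡n; +-mono-≤; +-identityʳ; +-comm)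
  open import Data.Nat.Tactic.RingSolver using (solve-∀)
  open import Relation.Binary.PropositionalEquality using (module ≡-Reasoning)
  open import Data.Empty using (⊥-elim)
  open import Data.List using (concatMap)
  open import Data.List.Membership.Propositional.Properties using (∈-upTo⁺; ∈-upTo⁻)
  open import Data.List.Relation.Unary.Unique.Propositional.Properties using (upTo⁺)
  open import Data.List.Relation.Unary.AllPairs using ([]; _∷_)
  import Data.List.Relation.Unary.All as All
  open import Data.List.Relation.Binary.Permutation.Propositional using (↭-sym)
  open import Data.List.Relation.Binary.Permutation.Propositional.Properties using (∈-resp-↭)
  open import Data.Product using (proj₁)
  open FiniteSums
  open Triangles
  open Indicators
  open Weights S n
  open Folding n

  a b : ℕ → ℕ
  a x = χ S x
  b x = χ S (n ∸ x)

  σ : ℕ → ℕ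
  σ k with k ≟ n ∸ k
  ... | yes _ = a k
  ... | no  _ = a k + b k

  private
    b≡a : ∀ {k} → k ≡ n ∸ k → b k ≡ a k
    b≡a k≡k̄ = cong (χ S) (sym k≡k̄)

    squares : ∀ {i} → a i * a i + b i * b i ≡ a i + b i
    squares {i} = cong₂ _+_ (χ-idem S i) (χ-idem S (n ∸ i))

  module _ {i j k : ℕ} (i<j : i < j) (j<k : j < k) (k≤m : k ≤ m) where
    private
      j≤m = ≤-trans (<⇒≤ j<k) k≤m
      i≤m = ≤-trans (<⇒≤ i<j) j≤m
      i<k = <-trans i<j j<k

    weight-blockA : weight S n (blockA i j k) ≡ σ k * (a i * a j + b i * b j)
    weight-blockA with k ≟ n ∸ k
    ... | yes k≡k̄ =
      trans (weight-doubled (cong (λ c → i , j , c) (sym k≡k̄)) (cong (λ c → c , n ∸ j , n ∸ i) (sym k≡k̄))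
                            (≢-at₁ (<⇒≢ i<k)) (≤n i≤m , ≤n j≤m , ≤n k≤m) (≤n k≤m , mirror≤n j , mirror≤n i))
            (collect (a i) (a j) (b i) (b j) (a k))
      where
      collect : ∀ ai aj bi bj ak → ai * aj * ak + (ak * bj * bi + 0) ≡ ak * (ai * aj + bi * bj)
      collect = solve-∀
    ... | no k≢k̄ =
      trans (weight-distinct
               ((≢-at₃ k≢k̄ All.∷ ≢-at₁ (<⇒≢ i<k) All.∷ ≢-at₁ (<mirror i<k k≤m) All.∷ All.[])
               ∷ (≢-at₁ (<⇒≢ i<k) All.∷ ≢-at₁ (<mirror i<k k≤m) All.∷ All.[])
               ∷ (≢-at₁ k≢k̄ All.∷ All.[]) ∷ All.[] ∷ [])
               ((≤n i≤m , ≤n j≤m , ≤n k≤m) All.∷ (≤n i≤m , ≤n j≤m , mirror≤n k)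
               All.∷ (≤n k≤m , mirror≤n j , mirror≤n i) All.∷ (mirror≤n k , mirror≤n j , mirror≤n i) All.∷ All.[]))
            (collect (a i) (a j) (b i) (b j) (a k) (b k))
      where
      collect : ∀ ai aj bi bj ak bk →
                ai * aj * ak + (ai * aj * bk + (ak * bj * bi + (bk * bj * bi + 0)))
                ≡ (ak + bk) * (ai * aj + bi * bj)
      collect = solve-∀

    weight-blockA′ : weight S n (blockA′ i j k) ≡ σ k * (a i * b j + a j * b i)
    weight-blockA′ with k ≟ n ∸ k
    ... | yes k≡k̄ =
      trans (weight-doubled (cong (λ c → i , c , n ∸ j) (sym k≡k̄)) (cong (λ c → j , c , n ∸ i) k≡k̄)
                            (≢-at₁ (<⇒≢ i<j)) (≤n i≤m , ≤n k≤m , mirror≤n j) (≤n j≤m , mirror≤n k , mirror≤n i))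
            (trans (cong (λ c → a i * a k * b j + (a j * c * b i + 0)) (b≡a k≡k̄))
                   (collect (a i) (a j) (b i) (b j) (a k)))
      where
      collect : ∀ ai aj bi bj ak → ai * ak * bj + (aj * ak * bi + 0) ≡ ak * (ai * bj + aj * bi)
      collect = solve-∀
    ... | no k≢k̄ =
      trans (weight-distinct
               ((≢-at₂ k≢k̄ All.∷ ≢-at₁ (<⇒≢ i<j) All.∷ ≢-at₁ (<⇒≢ i<j) All.∷ All.[])
               ∷ (≢-at₁ (<⇒≢ i<j) All.∷ ≢-at₁ (<⇒≢ i<j) All.∷ All.[])
               ∷ (≢-at₂ (λ k̄≡k → k≢k̄ (sym k̄≡k)) All.∷ All.[]) ∷ All.[] ∷ [])
               ((≤n i≤m , ≤n k≤m , mirror≤n j) All.∷ (≤n i≤m , mirror≤n k , mirror≤n j)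
               All.∷ (≤n j≤m , mirror≤n k , mirror≤n i) All.∷ (≤n j≤m , ≤n k≤m , mirror≤n i) All.∷ All.[]))
            (collect (a i) (a j) (b i) (b j) (a k) (b k))
      where
      collect : ∀ ai aj bi bj ak bk →
                ai * ak * bj + (ai * bk * bj + (aj * bk * bi + (aj * ak * bi + 0)))
                ≡ (ak + bk) * (ai * bj + aj * bi)
      collect = solve-∀

  module _ {i j : ℕ} (i<j : i < j) (j≤m : j ≤ m) where
    private
      i≤m = ≤-trans (<⇒≤ i<j) j≤m

    weight-blockB : weight S n (blockB i j) ≡ σ j * (a i + b i)
    weight-blockB with j ≟ n ∸ j
    ... | yes j≡j̄ =
      trans (weight-doubled (cong (λ c → i , i , c) (sym j≡j̄)) (cong (λ c → c , n ∸ i , n ∸ i) (sym j≡j̄))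
                            (≢-at₁ (<⇒≢ i<j)) (≤n i≤m , ≤n i≤m , ≤n j≤m) (≤n j≤m , mirror≤n i , mirror≤n i))
            (trans (collect (a i) (b i) (a j)) (cong (a j *_) squares))
      where
      collect : ∀ ai bi aj → ai * ai * aj + (aj * bi * bi + 0) ≡ aj * (ai * ai + bi * bi)
      collect = solve-∀
    ... | no j≢j̄ =
      trans (weight-distinct
               ((≢-at₃ j≢j̄ All.∷ ≢-at₁ (<⇒≢ i<j) All.∷ ≢-at₁ (<mirror i<j j≤m) All.∷ All.[])
               ∷ (≢-at₁ (<⇒≢ i<j) All.∷ ≢-at₁ (<mirror i<j j≤m) All.∷ All.[])
               ∷ (≢-at₁ j≢j̄ All.∷ All.[]) ∷ All.[] ∷ [])
               ((≤n i≤m , ≤n i≤m , ≤n j≤m) All.∷ (≤n i≤m , ≤n i≤m , mirror≤n j)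
               All.∷ (≤n j≤m , mirror≤n i , mirror≤n i) All.∷ (mirror≤n j , mirror≤n i , mirror≤n i) All.∷ All.[]))
            (trans (collect (a i) (b i) (a j) (b j)) (cong ((a j + b j) *_) squares))
      where
      collect : ∀ ai bi aj bj →
                ai * ai * aj + (ai * ai * bj + (aj * bi * bi + (bj * bi * bi + 0)))
                ≡ (aj + bj) * (ai * ai + bi * bi)
      collect = solve-∀

    weight-blockB′ : weight S n (blockB′ i j) ≡ σ j * (a i * b i)
    weight-blockB′ with j ≟ n ∸ j
    ... | yes j≡j̄ =
      trans (weight-twice (cong (λ c → i , c , n ∸ i) (sym j≡j̄)) (≤n i≤m , ≤n j≤m , mirror≤n i))
            (collect (a i) (b i) (a j))
      where
      collect : ∀ ai bi aj → ai * aj * bi + 0 ≡ aj * (ai * bi)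
      collect = solve-∀
    ... | no j≢j̄ =
      trans (weight-distinct ((≢-at₂ j≢j̄ All.∷ All.[]) ∷ All.[] ∷ [])
                             ((≤n i≤m , ≤n j≤m , mirror≤n i)
                             All.∷ (≤n i≤m , mirror≤n j , mirror≤n i) All.∷ All.[]))
            (collect (a i) (b i) (a j) (b j))
      where
      collect : ∀ ai bi aj bj → ai * aj * bi + (ai * bj * bi + 0) ≡ (aj + bj) * (ai * bi)
      collect = solve-∀

  same cross : ℕ → ℕ
  same  k = ∑₂ (λ i j → a i * a j + b i * b j) k
  cross k = ∑₂ (λ i j → a i * b j + a j * b i) k

  α β γ : ℕ → ℕ
  α K = ∑ (upTo K) a
  β K = ∑ (upTo K) b
  γ K = ∑ (upTo K) λ i → a i * b i

  ⟨σ,_⟩ : (ℕ → ℕ) → ℕ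
  ⟨σ, f ⟩ = ∑ (upTo M) λ k → σ k * f k

  weight-𝒜 : weight S n (𝒜 n) ≡ ⟨σ, same ⟩
  weight-𝒜 = trans (cong (weight S n) 𝒜≡⋃₃) (trans
    (weight-⋃₃ blockA M fold-max fold-mid fold-min λ i j k i<j j<k k<M t t∈ →
      All.lookup (blockA-folds i<j j<k (≤-pred k<M)) t∈)
    (∑₃-factor M _ σ _ λ i j k i<j j<k k<M → weight-blockA i<j j<k (≤-pred k<M)))

  weight-𝒜′ : weight S n (𝒜′ n) ≡ ⟨σ, cross ⟩
  weight-𝒜′ = trans (cong (weight S n) 𝒜′≡⋃₃) (trans
    (weight-⋃₃ blockA′ M fold-mid fold-max fold-min λ i j k i<j j<k k<M t t∈ →
      let max≡j , mid≡k , min≡i = All.lookup (blockA′-folds i<j j<k (≤-pred k<M)) t∈ in mid≡k , max≡j , min≡i)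
    (∑₃-factor M _ σ _ λ i j k i<j j<k k<M → weight-blockA′ i<j j<k (≤-pred k<M)))

  weight-ℬ : weight S n (ℬ n) ≡ ⟨σ, (λ j → ∑ (upTo j) λ i → a i + b i) ⟩
  weight-ℬ = trans (cong (weight S n) ℬ≡⋃₂) (trans
    (weight-⋃₂ blockB M fold-max fold-min λ i j i<j j<M t t∈ →
      let max≡j , _ , min≡i = All.lookup (blockB-folds i<j (≤-pred j<M)) t∈ in max≡j , min≡i)
    (∑₂-factor M _ σ _ λ i j i<j j<M → weight-blockB i<j (≤-pred j<M)))

  weight-ℬ′ : weight S n (ℬ′ n) ≡ ⟨σ, γ ⟩
  weight-ℬ′ = trans (cong (weight S n) ℬ′≡⋃₂) (trans
    (weight-⋃₂ blockB′ M fold-mid fold-min λ i j i<j j<M t t∈ →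
      let _ , mid≡j , min≡i = All.lookup (blockB′-folds i<j (≤-pred j<M)) t∈ in mid≡j , min≡i)
    (∑₂-factor M _ σ _ λ i j i<j j<M → weight-blockB′ i<j (≤-pred j<M)))

  weight-Γ̄ : weight S n (𝒜′ n ++ ℬ′ n) ≡ ⟨σ, (λ k → cross k + γ k) ⟩
  weight-Γ̄ = trans (weight-++ (𝒜′ n) (ℬ′ n) 𝒜′-ℬ′-disjoint)
                  (trans (cong₂ _+_ weight-𝒜′ weight-ℬ′) (sym (∑-weighted-+ (upTo M) σ cross γ)))

  χ³-diagonal : ∀ x → χ³ (diagonal x) ≡ χ S x
  χ³-diagonal x = trans (cong (_* χ S x) (χ-idem S x)) (χ-idem S x)

  weight-blockD : ∀ {v} → v ≤ m → weight S n (blockD v) ≡ σ v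
  weight-blockD {v} v≤m with v ≟ n ∸ v
  ... | yes v≡v̄ = trans (weight-twice (cong diagonal (sym v≡v̄)) (≤n v≤m , ≤n v≤m , ≤n v≤m))
                       (trans (+-identityʳ _) (χ³-diagonal v))
  ... | no  v≢v̄ = trans (weight-distinct ((≢-at₁ v≢v̄ All.∷ All.[]) ∷ All.[] ∷ [])
                                         ((≤n v≤m , ≤n v≤m , ≤n v≤m)
                                         All.∷ (mirror≤n v , mirror≤n v , mirror≤n v) All.∷ All.[]))
                       (cong₂ _+_ (χ³-diagonal v) (trans (+-identityʳ _) (χ³-diagonal (n ∸ v))))

  -- Regroup [0, n] into the pairs {v , n ∸ v}, v ≤ m, through the weight of the diagonal triples.
  ∑χ≡∑σ : ∑ (upTo (suc n)) (χ S) ≡ ∑ (upTo M) σ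
  ∑χ≡∑σ = begin
    ∑ U (χ S)
      ≡⟨ ∑-cong U (λ x x∈U → sym (trans weight-[ cube x∈U ] (χ³-diagonal x))) ⟩
    ∑ U (λ x → weight S n (diagonal x ∷ []))
      ≡⟨ sym (weight-concatMap (λ x → diagonal x ∷ []) proj₁ (upTo⁺ (suc n))
                               λ { _ _ _ (here refl) → refl ; _ _ _ (there ()) }) ⟩
    weight S n diagonals
      ≡⟨ weight-cong diagonals⊆blocks blocks⊆diagonals ⟩
    weight S n (concatMap blockD (upTo M))
      ≡⟨ weight-concatMap blockD (λ t → fold (proj₁ t)) (upTo⁺ M) blockD-folds ⟩
    ∑ (upTo M) (λ v → weight S n (blockD v))
      ≡⟨ ∑-cong (upTo M) (λ v v∈ → weight-blockD (≤-pred (∈-upTo⁻ v∈))) ⟩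
    ∑ (upTo M) σ ∎
    where
    open ≡-Reasoning
    U = upTo (suc n)
    cube : ∀ {x} → x ∈ U → InCube (diagonal x)
    cube x∈U = let x≤n = ≤-pred (∈-upTo⁻ x∈U) in x≤n , x≤n , x≤n

  length≡∑σ : Unique S → All (_≤ n) S → length S ≡ ∑ (upTo M) σ
  length≡∑σ S! S≤n =
    trans (sym (∑-𝟙-∈ S (upTo⁺ (suc n)) S! (All.map (λ x≤n → ∈-upTo⁺ (s≤s x≤n)) S≤n))) ∑χ≡∑σ
    where open Membership _≟_ using (∑-𝟙-∈)

  σ≤2 : ∀ k → σ k ≤ 2
  σ≤2 k with k ≟ n ∸ k
  ... | yes _ = ≤-trans (χ≤1 S k) (s≤s z≤n)
  ... | no  _ = +-mono-≤ (χ≤1 S k) (χ≤1 S (n ∸ k))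

  private
    bits-sum≡2 : ∀ {x y} → x ≤ 1 → y ≤ 1 → x + y ≡ 2 → x ≡ 1 × y ≡ 1
    bits-sum≡2 (s≤s z≤n) (s≤s z≤n) refl = refl , refl
    bits-sum≡2 z≤n       z≤n       ()
    bits-sum≡2 z≤n       (s≤s z≤n) ()
    bits-sum≡2 (s≤s z≤n) z≤n       ()

  σ≡2⇒∈ : ∀ k → σ k ≡ 2 → k ∈ S × n ∸ k ∈ S
  σ≡2⇒∈ k with k ≟ n ∸ k
  ... | yes _ = λ σk≡2 → ⊥-elim (2≰1 (subst (_≤ 1) σk≡2 (χ≤1 S k)))
    where
    2≰1 : ¬ (2 ≤ 1)
    2≰1 (s≤s ())
  ... | no  _ = λ σk≡2 →
    let ak≡1 , bk≡1 = bits-sum≡2 (χ≤1 S k) (χ≤1 S (n ∸ k)) σk≡2 in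
    χ≡1⇒∈ S k ak≡1 , χ≡1⇒∈ S (n ∸ k) bk≡1

  -- Both k and k′ give the sum n + k, so B₃ forces k′ ∈ {k , n ∸ k , k}.
  σ-two-once : IsB3 S → ∀ k k′ → k < M → k′ < M → σ k ≡ 2 → σ k′ ≡ 2 → k ≡ k′
  σ-two-once B3 k k′ k<M k′<M σk≡2 σk′≡2
    with σ≡2⇒∈ k σk≡2 | σ≡2⇒∈ k′ σk′≡2
  ... | k∈S , k̄∈S | k′∈S , k̄′∈S
    with ∈-resp-↭ (↭-sym (B3 k (n ∸ k) k k′ (n ∸ k′) k k∈S k̄∈S k∈S k′∈S k̄′∈S k∈S
                            (cong (_+ k) (trans (m+[n∸m]≡n (≤n (≤-pred k<M)))
                                                (sym (m+[n∸m]≡n (≤n (≤-pred k′<M))))))))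
                  (here refl)
  ... | here k′≡k                 = sym k′≡k
  ... | there (there (here k′≡k)) = sym k′≡k
  ... | there (here k′≡k̄)         =
    let k+k′≡n = trans (cong (k +_) k′≡k̄) (m+[n∸m]≡n (≤n (≤-pred k<M))) in
    trans (≤m-sum≡n⇒≡m (≤-pred k<M) (≤-pred k′<M) k+k′≡n)
          (sym (≤m-sum≡n⇒≡m (≤-pred k′<M) (≤-pred k<M) (trans (+-comm k′ k) k+k′≡n)))

module Bounds (S : List ℕ) (n : ℕ) where
  open import Data.Nat using (_+_; _*_; _∸_)
  open import Data.Nat.Properties
    using (_≟_; ≤-refl; ≤-trans; ≤-pred; <⇒≤; <⇒≢; <-≤-trans; ∸-monoʳ-≤; n≤1+n; *-monoʳ-≤;
           +-commutativeSemigroup; module ≤-Reasoning)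
  open import Algebra.Properties.CommutativeSemigroup +-commutativeSemigroup using (interchange)
  open import Data.Nat.Tactic.RingSolver using (solve-∀)
  open import Relation.Binary.PropositionalEquality using (subst₂; module ≡-Reasoning)
  open import Data.Empty using (⊥-elim)
  open import Data.List.Membership.Propositional.Properties using (∈-upTo⁻)
  open FiniteSums
  open SumsOfProducts
  open Indicators using (χ-idem)
  open Folding n
  open BlockWeights S n

  open CountingInequality σ σ≤2 using (ρ; B; W; bound)

  private
    σ-split : ∀ {k} → k < m → σ k ≡ a k + b k
    σ-split {k} k<m with k ≟ n ∸ k
    ... | yes k≡k̄ = ⊥-elim (<⇒≢ (<-≤-trans k<m (≤-trans (≤mirror ≤-refl) (∸-monoʳ-≤ n (<⇒≤ k<m)))) k≡k̄)
    ... | no  _   = refl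

  ρ≡α+β : ∀ K → K ≤ m → ρ K ≡ α K + β K
  ρ≡α+β zero    _   = refl
  ρ≡α+β (suc K) K<m = begin
    ρ (suc K)                  ≡⟨ ∑-upTo-suc K σ ⟩
    ρ K + σ K                  ≡⟨ cong₂ _+_ (ρ≡α+β K (≤-trans (n≤1+n K) K<m)) (σ-split K<m) ⟩
    (α K + β K) + (a K + b K)  ≡⟨ interchange (α K) (β K) (a K) (b K) ⟩
    (α K + a K) + (β K + b K)  ≡⟨ sym (cong₂ _+_ (∑-upTo-suc K a) (∑-upTo-suc K b)) ⟩
    α (suc K) + β (suc K)      ∎
    where open ≡-Reasoning

  2same+ρ≡α²+β² : ∀ k → k ≤ m → 2 * same k + ρ k ≡ α k * α k + β k * β k
  2same+ρ≡α²+β² k k≤m = begin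
    2 * same k + ρ k
      ≡⟨ cong₂ (λ x y → 2 * x + y) (∑₂-+ (λ i j → a i * a j) (λ i j → b i * b j) k) (ρ≡α+β k k≤m) ⟩
    2 * (∑₂ (λ i j → a i * a j) k + ∑₂ (λ i j → b i * b j) k) + (α k + β k)
      ≡⟨ regroup (∑₂ (λ i j → a i * a j) k) (∑₂ (λ i j → b i * b j) k) (α k) (β k) ⟩
    (2 * ∑₂ (λ i j → a i * a j) k + α k) + (2 * ∑₂ (λ i j → b i * b j) k + β k)
      ≡⟨ cong₂ _+_ (∑₂-square a (χ-idem S) k) (∑₂-square b (λ x → χ-idem S (n ∸ x)) k) ⟩
    α k * α k + β k * β k ∎
    where
    open ≡-Reasoning
    regroup : ∀ p q x y → 2 * (p + q) + (x + y) ≡ (2 * p + x) + (2 * q + y)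
    regroup = solve-∀

  2[cross+γ]≤2same+ρ : ∀ k → k ≤ m → 2 * (cross k + γ k) ≤ 2 * same k + ρ k
  2[cross+γ]≤2same+ρ k k≤m =
    subst₂ _≤_ (cong (2 *_) (sym (∑₂-cross a b k))) (sym (2same+ρ≡α²+β² k k≤m)) (2xy≤x²+y² (α k) (β k))

  2same+2[cross+γ]+ρ≡ρ² : ∀ k → k ≤ m → 2 * same k + 2 * (cross k + γ k) + ρ k ≡ ρ k * ρ k
  2same+2[cross+γ]+ρ≡ρ² k k≤m = begin
    2 * same k + 2 * (cross k + γ k) + ρ k
      ≡⟨ regroup (same k) (cross k + γ k) (ρ k) ⟩
    (2 * same k + ρ k) + 2 * (cross k + γ k)
      ≡⟨ cong₂ (λ x y → x + 2 * y) (2same+ρ≡α²+β² k k≤m) (∑₂-cross a b k) ⟩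
    α k * α k + β k * β k + 2 * (α k * β k)
      ≡⟨ square-of-sum (α k) (β k) ⟩
    (α k + β k) * (α k + β k)
      ≡⟨ sym (cong (λ x → x * x) (ρ≡α+β k k≤m)) ⟩
    ρ k * ρ k ∎
    where
    open ≡-Reasoning
    regroup : ∀ s c r → 2 * s + 2 * c + r ≡ (2 * s + r) + 2 * c
    regroup = solve-∀
    square-of-sum : ∀ x y → x * x + y * y + 2 * (x * y) ≡ (x + y) * (x + y)
    square-of-sum = solve-∀

  weight-ℬ≡B : weight S n (ℬ n) ≡ B M
  weight-ℬ≡B = trans weight-ℬ (∑-cong (upTo M) λ k k∈ →
    cong (σ k *_) (trans (∑-+ (upTo k) a b) (sym (ρ≡α+β k (≤-pred (∈-upTo⁻ k∈))))))

  Γ̄-upper-bound : 2 * weight S n (𝒜′ n ++ ℬ′ n) ≤ 2 * weight S n (𝒜 n) + weight S n (ℬ n)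
  Γ̄-upper-bound = begin
    2 * weight S n (𝒜′ n ++ ℬ′ n)
      ≡⟨ cong (2 *_) weight-Γ̄ ⟩
    2 * ⟨σ, (λ k → cross k + γ k) ⟩
      ≡⟨ sym (∑-weighted-* (upTo M) σ 2 _) ⟩
    ⟨σ, (λ k → 2 * (cross k + γ k)) ⟩
      ≤⟨ ∑-mono (upTo M) (λ k k∈ → *-monoʳ-≤ (σ k) (2[cross+γ]≤2same+ρ k (≤-pred (∈-upTo⁻ k∈)))) ⟩
    ⟨σ, (λ k → 2 * same k + ρ k) ⟩
      ≡⟨ ∑-weighted-+ (upTo M) σ (λ k → 2 * same k) ρ ⟩
    ⟨σ, (λ k → 2 * same k) ⟩ + B M
      ≡⟨ cong₂ _+_ (trans (∑-weighted-* (upTo M) σ 2 same) (cong (2 *_) (sym weight-𝒜))) (sym weight-ℬ≡B) ⟩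
    2 * weight S n (𝒜 n) + weight S n (ℬ n) ∎
    where open ≤-Reasoning

  W≡2Γ+2Γ̄+ℬ : W M ≡ 2 * weight S n (𝒜 n) + 2 * weight S n (𝒜′ n ++ ℬ′ n) + weight S n (ℬ n)
  W≡2Γ+2Γ̄+ℬ = begin
    W M
      ≡⟨ ∑-cong (upTo M) (λ k k∈ → cong (σ k *_) (sym (2same+2[cross+γ]+ρ≡ρ² k (≤-pred (∈-upTo⁻ k∈))))) ⟩
    ⟨σ, (λ k → 2 * same k + 2 * (cross k + γ k) + ρ k) ⟩
      ≡⟨ ∑-weighted-+ (upTo M) σ _ ρ ⟩
    ⟨σ, (λ k → 2 * same k + 2 * (cross k + γ k)) ⟩ + B M
      ≡⟨ cong (_+ B M) (∑-weighted-+ (upTo M) σ _ _) ⟩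
    ⟨σ, (λ k → 2 * same k) ⟩ + ⟨σ, (λ k → 2 * (cross k + γ k)) ⟩ + B M
      ≡⟨ cong₂ (λ x y → x + y + B M) (∑-weighted-* (upTo M) σ 2 same) (∑-weighted-* (upTo M) σ 2 _) ⟩
    2 * ⟨σ, same ⟩ + 2 * ⟨σ, (λ k → cross k + γ k) ⟩ + B M
      ≡⟨ sym (cong₂ _+_ (cong₂ (λ x y → 2 * x + 2 * y) weight-𝒜 weight-Γ̄) weight-ℬ≡B) ⟩
    2 * weight S n (𝒜 n) + 2 * weight S n (𝒜′ n ++ ℬ′ n) + weight S n (ℬ n) ∎
    where open ≡-Reasoning

  counting-bound : Unique S → All (_≤ n) S → IsB3 S →
                   12 * weight S n (ℬ n) + 2 * (length S * length S * length S)
                   ≤ 6 * (2 * weight S n (𝒜 n) + 2 * weight S n (𝒜′ n ++ ℬ′ n) + weight S n (ℬ n))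
                     + 9 * (length S * length S) + 14 * length S
  counting-bound S! S≤n B3 =
    subst (λ r → 12 * weight S n (ℬ n) + 2 * (r * r * r)
                 ≤ 6 * (2 * weight S n (𝒜 n) + 2 * weight S n (𝒜′ n ++ ℬ′ n) + weight S n (ℬ n))
                   + 9 * (r * r) + 14 * r)
          (sym (length≡∑σ S! S≤n))
          (subst₂ _≤_ (cong (λ x → 12 * x + 2 * (ρ M * ρ M * ρ M)) (sym weight-ℬ≡B))
                      (cong (λ x → 6 * x + 9 * (ρ M * ρ M) + 14 * ρ M) W≡2Γ+2Γ̄+ℬ)
                      (bound M (σ-two-once B3) M ≤-refl))

module RationalBounds where
  import Data.Nat as ℕ
  open import Data.Integer using (+_)
  import Data.Integer as ℤ
  import Data.Integer.Properties as ℤ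
  open import Data.Rational using (ℚ; 0ℚ; ½; mkℚ; _/_; _+_; _-_; _*_; -_; *≤*) renaming (_≤_ to _≤ℚ_)
  import Data.Rational.Properties as ℚ
  open import Data.Nat.Coprimality using (1-coprimeTo) renaming (sym to coprime-sym)
  open import Data.Rational.Solver using (module +-*-Solver)
  open +-*-Solver using (solve; _:+_; _:*_; _:-_; :-_; con; _:=_)
  open import Relation.Binary.PropositionalEquality using (subst₂)

  private
    toℚ≡mkℚ : ∀ k → toℚ k ≡ mkℚ (+ k) 0 (coprime-sym (1-coprimeTo k))
    toℚ≡mkℚ k = ℚ.normalize-coprime (coprime-sym (1-coprimeTo k))

    toℚ-+ : ∀ x y → toℚ (x ℕ.+ y) ≡ toℚ x + toℚ y
    toℚ-+ x y = sym (trans (cong₂ _+_ (toℚ≡mkℚ x) (toℚ≡mkℚ y))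
                           (cong (_/ 1) (cong₂ ℤ._+_ (ℤ.*-identityʳ (+ x)) (ℤ.*-identityʳ (+ y)))))

    toℚ-* : ∀ x y → toℚ (x ℕ.* y) ≡ toℚ x * toℚ y
    toℚ-* x y = sym (trans (cong₂ _*_ (toℚ≡mkℚ x) (toℚ≡mkℚ y)) (cong (_/ 1) (sym (ℤ.pos-* x y))))

    toℚ-mono : ∀ {x y} → x ≤ y → toℚ x ≤ℚ toℚ y
    toℚ-mono {x} {y} x≤y = subst₂ _≤ℚ_ (sym (toℚ≡mkℚ x)) (sym (toℚ≡mkℚ y))
      (*≤* (subst₂ ℤ._≤_ (sym (ℤ.*-identityʳ (+ x))) (sym (ℤ.*-identityʳ (+ y))) (ℤ.+≤+ x≤y)))

    +-hom : ∀ x y {p q} → toℚ x ≡ p → toℚ y ≡ q → toℚ (x ℕ.+ y) ≡ p + q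
    +-hom x y x≡p y≡q = trans (toℚ-+ x y) (cong₂ _+_ x≡p y≡q)

    *-hom : ∀ x y {p q} → toℚ x ≡ p → toℚ y ≡ q → toℚ (x ℕ.* y) ≡ p * q
    *-hom x y x≡p y≡q = trans (toℚ-* x y) (cong₂ _*_ x≡p y≡q)

  Δ-nonneg : ∀ A B C → 2 ℕ.* C ≤ 2 ℕ.* A ℕ.+ B → 0ℚ ≤ℚ (toℚ A + ½ * toℚ B) - toℚ C
  Δ-nonneg A B C 2C≤2A+B = subst₂ _≤ℚ_ left right (ℚ.+-monoˡ-≤ (- c) (ℚ.*-monoˡ-≤-nonNeg ½ 2c≤2a+b))
    where
    a = toℚ A
    b = toℚ B
    c = toℚ C
    2c≤2a+b : toℚ 2 * c ≤ℚ toℚ 2 * a + b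
    2c≤2a+b = subst₂ _≤ℚ_ (toℚ-* 2 C) (+-hom (2 ℕ.* A) B (toℚ-* 2 A) refl) (toℚ-mono 2C≤2A+B)
    left : ½ * (toℚ 2 * c) + - c ≡ 0ℚ
    left = solve 1 (λ c → con ½ :* (con (toℚ 2) :* c) :+ :- c := con 0ℚ) refl c
    right : ½ * (toℚ 2 * a + b) + - c ≡ (a + ½ * b) - c
    right = solve 3 (λ a b c → con ½ :* (con (toℚ 2) :* a :+ b) :+ :- c := (a :+ con ½ :* b) :- c) refl a b c

  Γ-lower-bound : ∀ A B C r →
    12 ℕ.* B ℕ.+ 2 ℕ.* (r ℕ.* r ℕ.* r) ≤ 6 ℕ.* (2 ℕ.* A ℕ.+ 2 ℕ.* C ℕ.+ B) ℕ.+ 9 ℕ.* (r ℕ.* r) ℕ.+ 14 ℕ.* r →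
    (+ 1 / 12) * (toℚ r * toℚ r * toℚ r) + (+ 1 / 2) * ((toℚ A + ½ * toℚ B) - toℚ C)
      - (+ 3 / 8) * (toℚ r * toℚ r) - (+ 7 / 12) * toℚ r ≤ℚ toℚ A
  Γ-lower-bound A B C r bound = subst₂ _≤ℚ_ left right (ℚ.+-monoˡ-≤ slack (ℚ.*-monoˡ-≤-nonNeg (+ 1 / 24) X≤Y))
    where
    a = toℚ A
    b = toℚ B
    c = toℚ C
    s = toℚ r
    X Y slack : ℚ
    X = toℚ 12 * b + toℚ 2 * (s * s * s)
    Y = toℚ 6 * (toℚ 2 * a + toℚ 2 * c + b) + toℚ 9 * (s * s) + toℚ 14 * s
    slack = a - (+ 1 / 24) * Y
    X≤Y : X ≤ℚ Y
    X≤Y = subst₂ _≤ℚ_ toℚ-lhs toℚ-rhs (toℚ-mono bound)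
      where
      r² r³ : ℕ
      r² = r ℕ.* r
      r³ = r ℕ.* r ℕ.* r
      toℚ-r³ : toℚ r³ ≡ s * s * s
      toℚ-r³ = *-hom r² r (toℚ-* r r) refl
      toℚ-lhs : toℚ (12 ℕ.* B ℕ.+ 2 ℕ.* (r ℕ.* r ℕ.* r)) ≡ X
      toℚ-lhs = +-hom (12 ℕ.* B) (2 ℕ.* r³) (toℚ-* 12 B) (*-hom 2 r³ refl toℚ-r³)
      toℚ-rhs : toℚ (6 ℕ.* (2 ℕ.* A ℕ.+ 2 ℕ.* C ℕ.+ B) ℕ.+ 9 ℕ.* (r ℕ.* r) ℕ.+ 14 ℕ.* r) ≡ Y
      toℚ-rhs = +-hom (6 ℕ.* (2 ℕ.* A ℕ.+ 2 ℕ.* C ℕ.+ B) ℕ.+ 9 ℕ.* r²) (14 ℕ.* r)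
                  (+-hom (6 ℕ.* (2 ℕ.* A ℕ.+ 2 ℕ.* C ℕ.+ B)) (9 ℕ.* r²)
                     (*-hom 6 (2 ℕ.* A ℕ.+ 2 ℕ.* C ℕ.+ B) refl
                        (+-hom (2 ℕ.* A ℕ.+ 2 ℕ.* C) B (+-hom (2 ℕ.* A) (2 ℕ.* C) (toℚ-* 2 A) (toℚ-* 2 C)) refl))
                     (*-hom 9 r² refl (toℚ-* r r)))
                  (toℚ-* 14 r)

    left : (+ 1 / 24) * X + slack
           ≡ (+ 1 / 12) * (s * s * s) + (+ 1 / 2) * ((a + ½ * b) - c) - (+ 3 / 8) * (s * s) - (+ 7 / 12) * s
    left = solve 4 (λ a b c s →
       con (+ 1 / 24) :* (con (toℚ 12) :* b :+ con (toℚ 2) :* (s :* s :* s)) :+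
         (a :- con (+ 1 / 24) :* (con (toℚ 6) :* (con (toℚ 2) :* a :+ con (toℚ 2) :* c :+ b)
                                  :+ con (toℚ 9) :* (s :* s) :+ con (toℚ 14) :* s))
       := con (+ 1 / 12) :* (s :* s :* s) :+ con (+ 1 / 2) :* ((a :+ con ½ :* b) :- c)
          :- con (+ 3 / 8) :* (s :* s) :- con (+ 7 / 12) :* s)
       refl a b c s
    right : (+ 1 / 24) * Y + slack ≡ a
    right = solve 2 (λ a y → con (+ 1 / 24) :* y :+ (a :- con (+ 1 / 24) :* y) := a) refl a Y

open import Data.Integer using (+_)
open import Data.Rational using (ℚ; 0ℚ; _/_; _+_; _-_; _*_) renaming (_≤_ to _≤ℚ_)

lemma2 : (n : ℕ) → 1 ≤ n → (S : List ℕ) → Unique S → All (_≤ n) S → IsB3 S →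
         (0ℚ ≤ℚ Δ S n)
         × ((+ 1 / 12) * (toℚ (length S) * toℚ (length S) * toℚ (length S))
              + (+ 1 / 2) * Δ S n
              - (+ 3 / 8) * (toℚ (length S) * toℚ (length S))
              - (+ 7 / 12) * toℚ (length S)
            ≤ℚ Γ S n)
lemma2 n _ S S! S≤n B3 =
    Δ-nonneg (weight S n (𝒜 n)) (weight S n (ℬ n)) (weight S n (𝒜′ n ++ ℬ′ n)) Γ̄-upper-bound
  , Γ-lower-bound (weight S n (𝒜 n)) (weight S n (ℬ n)) (weight S n (𝒜′ n ++ ℬ′ n)) (length S)
                  (counting-bound S! S≤n B3)
  where
  open Bounds S n using (Γ̄-upper-bound; counting-bound)
  open RationalBounds using (Δ-nonneg; Γ-lower-bound)
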